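{- (1) For every $A\in\mathcal P_{\mathrm{fin},0}(\mathbb N_0)$, we have $[\![A]\!]=\mathcal P_{\mathrm{fin},0}(\mathbb N_0)$ if and only if $1\in A\cap\mathrm{rev}(A)$. (2) The only maximal divisor-closed submonoids of $\mathcal P_{\mathrm{fin},0}(\mathbb N_0)$ are $\mathcal P_{\mathrm{fin},0}(\mathbb N_0\setminus\{1\})$ and $\mathrm{rev}\big(\mathcal P_{\mathrm{fin},0}(\mathbb N_0\setminus\{1\})\big)$. More generally, given numerical monoids $S_1$ and $S_2$, the maximal divisor-closed submonoids of $\mathcal P_{\mathrm{fin},0}(S_1)\cap\mathrm{rev}(\mathcal P_{\mathrm{fin},0}(S_2))$ are precisely the monoids $\mathcal P_{\mathrm{fin},0}(S_1')\cap\mathrm{rev}(\mathcal P_{\mathrm{fin},0}(S_2))$ and $\mathcal P_{\mathrm{fin},0}(S_1)\cap\mathrm{rev}(\mathcal P_{\mathrm{fin},0}(S_2'))$, where $S_1'$ and $S_2'$ range over the maximal proper submonoids of $S_1$ and $S_2$, respectively. (3) There is a descending chain of divisor-closed submonoids of $\mathcal P_{\mathrm{fin},0}(\mathbb N_0)$ that does not become stationary. (4) Every ascending chain of divisor-closed submonoids of $\mathcal P_{\mathrm{fin},0}(\mathbb N_0)$ becomes stationary.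
   Context: A numerical monoid is an additive submonoid of $\mathbb N_0$ with $\gcd 1$. For a submonoid $S\subset\mathbb N_0$, $\mathcal P_{\mathrm{fin},0}(S)$ is the monoid of finite subsets of $S$ containing $0$ under set addition $A+B=\{a+b\colon a\in A,b\in B\}$ (identity $\{0\}$). For $B\in\mathcal P_{\mathrm{fin},0}(\mathbb N_0)$, $\mathrm{rev}(B)=\max B-B=\{\max B-b\colon b\in B\}$, and $\mathrm{rev}(H)=\{\mathrm{rev}(B)\colon B\in H\}$. $B$ divides $D$ if $D=B+C$ for some $C$ in the monoid; a submonoid is divisor-closed (in an ambient monoid $M$) if it contains all divisors in $M$ of its elements; a maximal divisor-closed submonoid of $M$ is a proper divisor-closed submonoid of $M$ not properly contained in any other proper divisor-closed submonoid of $M$. $[\![A]\!]=\{B\in\mathcal P_{\mathrm{fin},0}(\mathbb N_0)\colon B\text{ divides }nA\text{ for some }n\in\mathbb N_0\}$ is the smallest divisor-closed submonoid of $\mathcal P_{\mathrm{fin},0}(\mathbb N_0)$ containing $A$, where $nA$ is the $n$-fold sumset. -}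

module Defs where

open import Level using (0ℓ)
open import Data.Nat using (ℕ; zero; suc; _+_; _∸_; _⊔_; _≤_)
open import Data.Nat.Divisibility using (_∣_)
open import Data.List using (List; []; _∷_; map; concatMap; foldr)
open import Data.List.Membership.Propositional using (_∈_)
open import Data.List.Relation.Unary.All using (All)
open import Data.Product using (Σ; _×_; ∃; ∃-syntax)
open import Data.Sum using (_⊎_)
open import Relation.Nullary using (¬_)
open import Relation.Binary.PropositionalEquality using (_≡_)
open import Function.Bundles using (_⇔_)

NSet : Set₁
NSet = ℕ → Set

_⊆ₙ_ : NSet → NSet → Set
S ⊆ₙ T = ∀ n → S n → T n

_≐ₙ_ : NSet → NSet → Set
S ≐ₙ T = (S ⊆ₙ T) × (T ⊆ₙ S)

IsSubmonoidℕ : NSet → Set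
IsSubmonoidℕ S = S 0 × (∀ m n → S m → S n → S (m + n))

IsNumericalMonoid : NSet → Set
IsNumericalMonoid S =
  IsSubmonoidℕ S × (∀ d → (∀ s → S s → d ∣ s) → d ≡ 1)

IsMaxProperSubmonoid : NSet → NSet → Set₁
IsMaxProperSubmonoid S S' =
  IsSubmonoidℕ S' × (S' ⊆ₙ S) × (∃[ x ] (S x × ¬ S' x)) ×
  (∀ (T : NSet) → IsSubmonoidℕ T → S' ⊆ₙ T → T ⊆ₙ S → (T ⊆ₙ S') ⊎ (S ⊆ₙ T))

ℕ₀ : NSet
ℕ₀ _ = ℕ

ℕ₀∖1 : NSet
ℕ₀∖1 n = ¬ (n ≡ 1)

-- Finite subsets of ℕ₀, represented by lists (set = membership;
-- two lists represent the same finite set iff they are ≈)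

FSet : Set
FSet = List ℕ

_≈_ : FSet → FSet → Set
A ≈ B = ∀ x → (x ∈ A) ⇔ (x ∈ B)

_⊕_ : FSet → FSet → FSet
A ⊕ B = concatMap (λ a → map (a +_) B) A

𝟘 : FSet
𝟘 = 0 ∷ []

_·_ : ℕ → FSet → FSet
zero  · A = 𝟘
suc n · A = A ⊕ (n · A)

maxF : FSet → ℕ
maxF = foldr _⊔_ 0

rev : FSet → FSet
rev B = map (maxF B ∸_) B

FPred : Set₁
FPred = FSet → Set

_⊆_ : FPred → FPred → Set
H ⊆ K = ∀ A → H A → K A

_≐_ : FPred → FPred → Set
H ≐ K = (H ⊆ K) × (K ⊆ H)

_∩_ : FPred → FPred → FPred
(H ∩ K) A = H A × K A

Pfin0 : NSet → FPred
Pfin0 S A = (0 ∈ A) × All S A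

revP : FPred → FPred
revP H D = ∃[ B ] (H B × (D ≈ rev B))

-- H is a submonoid of the ambient monoid M (H is a set of finite sets,
-- i.e. closed under ≈)
IsSubmonoid : FPred → FPred → Set
IsSubmonoid M H =
  (H ⊆ M) × H 𝟘 × (∀ A B → H A → H B → H (A ⊕ B)) ×
  (∀ A B → A ≈ B → H A → H B)

Divides : FPred → FSet → FSet → Set
Divides M B D = M B × ∃[ C ] (M C × (D ≈ (B ⊕ C)))

IsDivisorClosedSubmonoid : FPred → FPred → Set
IsDivisorClosedSubmonoid M H =
  IsSubmonoid M H × (∀ B D → H D → Divides M B D → H B)

IsProper : FPred → FPred → Set
IsProper M H = ∃[ A ] (M A × ¬ H A)

IsMaxDivisorClosed : FPred → FPred → Set₁
IsMaxDivisorClosed M H =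
  IsDivisorClosedSubmonoid M H × IsProper M H ×
  (∀ (K : FPred) → IsDivisorClosedSubmonoid M K → IsProper M K →
     H ⊆ K → K ⊆ H)

⟦_⟧ : FSet → FPred
⟦ A ⟧ B = ∃[ n ] Divides (Pfin0 ℕ₀) B (n · A)

Descending : (ℕ → FPred) → Set
Descending H = ∀ n → H (suc n) ⊆ H n

Ascending : (ℕ → FPred) → Set
Ascending H = ∀ n → H n ⊆ H (suc n)

Stationary : (ℕ → FPred) → Set
Stationary H = ∃[ N ] (∀ m → N ≤ m → H m ≐ H N)

{-# OPTIONS --safe #-}
module Submission where

-- A divisor-closed submonoid H of Pfin0 S₁ ∩ rev (Pfin0 S₂) is determined by two
-- submonoids of ℕ₀: the elements of its members and the elements of their reversals.
-- H consists of all B whose elements and reflected elements lie in these monoids,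
-- because such a B is built into one E ∈ H (containing B and a shift B + k) and then
-- divides (max E + 1) E; this uses that (p + 1) E = p E ∪ (max E + p E) for
-- p ≥ max E, by a pigeonhole (zero-sum) argument. Hence divisor-closed submonoids
-- correspond to pairs of submonoids, and the four statements reduce to facts on
-- submonoids of ℕ₀: maximal proper submonoids of a numerical monoid are S ∖ {atom}
-- and cofinite, a monoid containing 1 is ℕ₀, and ascending chains stabilise since
-- each residue class modulo a nonzero element is eventually captured.

open import Defs

-- Data.Nat's suc is opened only in this module: the statement of theorem4p5 uses Level's suc.
module _ where

  open import Level using (0ℓ)
  open import Axiom.ExcludedMiddle using (ExcludedMiddle)
  open import Data.Nat
  open import Data.Nat.Properties
  open import Data.Nat.Induction using (<-rec)
  open import Data.Nat.Divisibility using (_∣_; divides; ∣1⇒≡1)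
  open import Data.Nat.DivMod using (_%_; _/_; _mod_; m≡m%n+[m/n]*n; m%n<n)
  open import Data.Nat.ListAction using (sum)
  open import Data.Nat.ListAction.Properties using (sum-++)
  open import Data.Nat.Tactic.RingSolver using (solve-∀)
  open import Data.Fin using (toℕ)
  open import Data.Fin.Properties using (pigeonhole; toℕ-fromℕ<; toℕ<n)
  open import Data.List using ([]; _∷_; map; _++_; length; take; drop)
  open import Data.List.Properties using (length-++; length-take; length-drop; take-take; take++drop≡id; ++-assoc)
  open import Data.List.Membership.Propositional using (_∈_; find)
  open import Data.List.Membership.Propositional.Properties using (∈-map⁺; ∈-map⁻; ∈-++⁺ˡ; ∈-++⁺ʳ; ∈-++⁻)
  open import Data.List.Relation.Unary.Any using (here; there)
  open import Data.List.Relation.Unary.All as All using (All; []; _∷_)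
  open import Data.List.Relation.Unary.All.Properties using (++⁻ˡ; ++⁻ʳ; ¬All⇒Any¬)
  open import Data.List.Relation.Binary.Subset.Propositional.Properties using (All-resp-⊇)
  open import Data.Product using (_×_; _,_; ∃-syntax; proj₁; proj₂; map₂)
  open import Data.Sum using (_⊎_; inj₁; inj₂) renaming (map to ⊎-map)
  open import Data.Empty using (⊥-elim)
  open import Relation.Nullary using (¬_; yes; no)
  open import Relation.Binary.PropositionalEquality
  open import Relation.Binary.Structures using (IsEquivalence)
  open import Function.Base using (_∘_)
  open import Function.Bundles using (_⇔_; mk⇔; Equivalence)
  open import Function.Properties.Equivalence using (⇔-isEquivalence)

  private
    variable
      A B C D E : FSet
      a b x : ℕ
      S S′ S₁ S₂ T₁ T₂ : NSet
      H K M M′ : FPred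

  -- Sumsets and reflection of finite sets

  module ⇔ {ℓ} = IsEquivalence (⇔-isEquivalence {ℓ})

  ≈-refl : A ≈ A
  ≈-refl x = ⇔.refl

  ≈-sym : A ≈ B → B ≈ A
  ≈-sym p x = ⇔.sym (p x)

  ≈-trans : A ≈ B → B ≈ C → A ≈ C
  ≈-trans p q x = ⇔.trans (p x) (q x)

  ∈-≈⁺ : A ≈ B → x ∈ A → x ∈ B
  ∈-≈⁺ {x = x} p = Equivalence.to (p x)

  ∈-≈⁻ : A ≈ B → x ∈ B → x ∈ A
  ∈-≈⁻ {x = x} p = Equivalence.from (p x)

  mk≈ : (∀ {x} → x ∈ A → x ∈ B) → (∀ {x} → x ∈ B → x ∈ A) → A ≈ B
  mk≈ f g x = mk⇔ f g

  ∈-⊕⁺ : a ∈ A → b ∈ B → a + b ∈ A ⊕ B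
  ∈-⊕⁺ {A = a ∷ A} {B = B} (here refl) q = ∈-++⁺ˡ (∈-map⁺ (a +_) q)
  ∈-⊕⁺ {A = a ∷ A} {B = B} (there p)   q = ∈-++⁺ʳ (map (a +_) B) (∈-⊕⁺ p q)

  ∈-⊕⁺′ : a ∈ A → b ∈ B → x ≡ a + b → x ∈ A ⊕ B
  ∈-⊕⁺′ p q refl = ∈-⊕⁺ p q

  ∈-⊕⁻ : ∀ A {B x} → x ∈ A ⊕ B → ∃[ a ] ∃[ b ] (a ∈ A × b ∈ B × x ≡ a + b)
  ∈-⊕⁻ (a ∷ A) {B = B} p with ∈-++⁻ (map (a +_) B) p
  ... | inj₁ q with ∈-map⁻ (a +_) q
  ...   | b , b∈ , eq = a , b , here refl , b∈ , eq
  ∈-⊕⁻ (a ∷ A) p | inj₂ q with ∈-⊕⁻ A q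
  ...   | a′ , b , a∈ , b∈ , eq = a′ , b , there a∈ , b∈ , eq

  ∈-⊕ˡ : x ∈ A → 0 ∈ B → x ∈ A ⊕ B
  ∈-⊕ˡ {x = x} p q = ∈-⊕⁺′ p q (sym (+-identityʳ x))

  ∈-⊕ʳ : 0 ∈ A → x ∈ B → x ∈ A ⊕ B
  ∈-⊕ʳ p q = ∈-⊕⁺ p q

  ⊕-cong : A ≈ B → C ≈ D → (A ⊕ C) ≈ (B ⊕ D)
  ⊕-cong {A} {B} {C} {D} p q = mk≈ (go p q) (go (≈-sym p) (≈-sym q))
    where
    go : ∀ {A B C D} → A ≈ B → C ≈ D → ∀ {x} → x ∈ A ⊕ C → x ∈ B ⊕ D
    go {A} p q r with ∈-⊕⁻ A r
    ... | a , c , a∈ , c∈ , refl = ∈-⊕⁺ (∈-≈⁺ p a∈) (∈-≈⁺ q c∈)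

  ⊕-comm : ∀ A B → (A ⊕ B) ≈ (B ⊕ A)
  ⊕-comm A B = mk≈ (go A B) (go B A)
    where
    go : ∀ A B {x} → x ∈ A ⊕ B → x ∈ B ⊕ A
    go A B p with ∈-⊕⁻ A p
    ... | a , b , a∈ , b∈ , refl = ∈-⊕⁺′ b∈ a∈ (+-comm a b)

  ⊕-assoc : ∀ A B C → ((A ⊕ B) ⊕ C) ≈ (A ⊕ (B ⊕ C))
  ⊕-assoc A B C = mk≈ to from
    where
    to : ∀ {x} → x ∈ (A ⊕ B) ⊕ C → x ∈ A ⊕ (B ⊕ C)
    to p with ∈-⊕⁻ (A ⊕ B) p
    ... | ab , c , ab∈ , c∈ , refl with ∈-⊕⁻ A ab∈
    ...   | a , b , a∈ , b∈ , refl = ∈-⊕⁺′ a∈ (∈-⊕⁺ b∈ c∈) (+-assoc a b c)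
    from : ∀ {x} → x ∈ A ⊕ (B ⊕ C) → x ∈ (A ⊕ B) ⊕ C
    from p with ∈-⊕⁻ A p
    ... | a , bc , a∈ , bc∈ , refl with ∈-⊕⁻ B bc∈
    ...   | b , c , b∈ , c∈ , refl = ∈-⊕⁺′ (∈-⊕⁺ a∈ b∈) c∈ (sym (+-assoc a b c))

  ⊕-identityˡ : ∀ A → (𝟘 ⊕ A) ≈ A
  ⊕-identityˡ A = mk≈ to (∈-⊕ʳ {A = 𝟘} (here refl))
    where
    to : ∀ {x} → x ∈ 𝟘 ⊕ A → x ∈ A
    to p with ∈-⊕⁻ 𝟘 p
    ... | .0 , b , here refl , b∈ , refl = b∈

  ⊕-interchange : ∀ A B C D → ((A ⊕ B) ⊕ (C ⊕ D)) ≈ ((A ⊕ C) ⊕ (B ⊕ D))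
  ⊕-interchange A B C D =
    ≈-trans (⊕-assoc A B (C ⊕ D))
    (≈-trans (⊕-cong (≈-refl {A}) (≈-trans (≈-sym (⊕-assoc B C D))
                     (≈-trans (⊕-cong (⊕-comm B C) (≈-refl {D})) (⊕-assoc C B D))))
    (≈-sym (⊕-assoc A C (B ⊕ D))))

  ·-+ : ∀ m n A → ((m + n) · A) ≈ ((m · A) ⊕ (n · A))
  ·-+ zero    n A = ≈-sym (⊕-identityˡ (n · A))
  ·-+ (suc m) n A = ≈-trans (⊕-cong (≈-refl {A}) (·-+ m n A)) (≈-sym (⊕-assoc A (m · A) (n · A)))

  0∈· : ∀ n → 0 ∈ A → 0 ∈ n · A
  0∈· zero      z = here refl
  0∈· (suc n) z = ∈-⊕⁺ z (0∈· n z)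

  maxF-upper : x ∈ A → x ≤ maxF A
  maxF-upper {A = a ∷ A} (here refl) = m≤m⊔n a (maxF A)
  maxF-upper {A = a ∷ A} (there p)   = ≤-trans (maxF-upper p) (m≤n⊔m a (maxF A))

  maxF-least : ∀ {A m} → (∀ {x} → x ∈ A → x ≤ m) → maxF A ≤ m
  maxF-least {[]}    f = z≤n
  maxF-least {a ∷ A} f = ⊔-lub (f (here refl)) (maxF-least (λ p → f (there p)))

  maxF-∈ : x ∈ A → maxF A ∈ A
  maxF-∈ {A = a ∷ A} _ = go a A
    where
    go : ∀ a A → maxF (a ∷ A) ∈ a ∷ A
    go a []      rewrite ⊔-identityʳ a = here refl
    go a (b ∷ A) with ⊔-sel a (maxF (b ∷ A))
    ... | inj₁ eq rewrite eq = here refl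
    ... | inj₂ eq rewrite eq = there (go b A)

  maxF-unique : ∀ {A m} → m ∈ A → (∀ {x} → x ∈ A → x ≤ m) → maxF A ≡ m
  maxF-unique m∈ f = ≤-antisym (maxF-least f) (maxF-upper m∈)

  maxF-cong : A ≈ B → maxF A ≡ maxF B
  maxF-cong p = ≤-antisym (maxF-least (λ q → maxF-upper (∈-≈⁺ p q)))
                          (maxF-least (λ q → maxF-upper (∈-≈⁻ p q)))

  maxF-⊕ : 0 ∈ A → 0 ∈ B → maxF (A ⊕ B) ≡ maxF A + maxF B
  maxF-⊕ {A} {B} zA zB = maxF-unique (∈-⊕⁺ (maxF-∈ zA) (maxF-∈ zB)) bound
    where
    bound : ∀ {x} → x ∈ A ⊕ B → x ≤ maxF A + maxF B
    bound r with ∈-⊕⁻ A r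
    ... | a , b , a∈ , b∈ , refl = +-mono-≤ (maxF-upper a∈) (maxF-upper b∈)

  ∈-rev⁺ : a ∈ A → maxF A ∸ a ∈ rev A
  ∈-rev⁺ {A = A} = ∈-map⁺ (maxF A ∸_)

  ∈-rev⁺′ : a ∈ A → x ≡ maxF A ∸ a → x ∈ rev A
  ∈-rev⁺′ p refl = ∈-rev⁺ p

  ∈-rev⁻ : x ∈ rev A → ∃[ a ] (a ∈ A × x ≡ maxF A ∸ a)
  ∈-rev⁻ {A = A} = ∈-map⁻ (maxF A ∸_)

  0∈rev : x ∈ A → 0 ∈ rev A
  0∈rev {A = A} p = ∈-rev⁺′ (maxF-∈ p) (sym (n∸n≡0 (maxF A)))

  maxF-rev : 0 ∈ A → maxF (rev A) ≡ maxF A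
  maxF-rev {A} z = maxF-unique (∈-rev⁺ z) bound
    where
    bound : ∀ {x} → x ∈ rev A → x ≤ maxF A
    bound q with ∈-rev⁻ q
    ... | a , _ , refl = m∸n≤m (maxF A) a

  rev-involutive : 0 ∈ A → rev (rev A) ≈ A
  rev-involutive {A} z = mk≈ to from
    where
    to : ∀ {x} → x ∈ rev (rev A) → x ∈ A
    to q with ∈-rev⁻ q
    ... | y , y∈ , refl with ∈-rev⁻ y∈
    ...   | a , a∈ , refl rewrite maxF-rev z | m∸[m∸n]≡n (maxF-upper a∈) = a∈
    from : ∀ {x} → x ∈ A → x ∈ rev (rev A)
    from {x} q = ∈-rev⁺′ (∈-rev⁺ q)
      (trans (sym (m∸[m∸n]≡n (maxF-upper q))) (cong (_∸ (maxF A ∸ x)) (sym (maxF-rev z))))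

  [m+n]∸[o+p]≡[m∸o]+[n∸p] : ∀ {m n o p} → o ≤ m → p ≤ n → (m + n) ∸ (o + p) ≡ (m ∸ o) + (n ∸ p)
  [m+n]∸[o+p]≡[m∸o]+[n∸p] {m} {n} {o} {p} o≤m p≤n = begin
    (m + n) ∸ (o + p)   ≡⟨ sym (∸-+-assoc (m + n) o p) ⟩
    (m + n) ∸ o ∸ p     ≡⟨ cong (_∸ p) (+-∸-comm n o≤m) ⟩
    (m ∸ o + n) ∸ p     ≡⟨ +-∸-assoc (m ∸ o) p≤n ⟩
    (m ∸ o) + (n ∸ p)   ∎
    where open ≡-Reasoning

  rev-cong : A ≈ B → rev A ≈ rev B
  rev-cong {A} {B} p = mk≈ (go p) (go (≈-sym p))
    where
    go : ∀ {A B} → A ≈ B → ∀ {x} → x ∈ rev A → x ∈ rev B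
    go p q with ∈-rev⁻ q
    ... | a , a∈ , refl = ∈-rev⁺′ (∈-≈⁺ p a∈) (cong (_∸ a) (maxF-cong p))

  rev-⊕ : 0 ∈ A → 0 ∈ B → rev (A ⊕ B) ≈ (rev A ⊕ rev B)
  rev-⊕ {A} {B} zA zB = mk≈ to from
    where
    to : ∀ {x} → x ∈ rev (A ⊕ B) → x ∈ rev A ⊕ rev B
    to q with ∈-rev⁻ q
    ... | _ , ab∈ , refl with ∈-⊕⁻ A ab∈
    ...   | a , b , a∈ , b∈ , refl rewrite maxF-⊕ zA zB
            | [m+n]∸[o+p]≡[m∸o]+[n∸p] (maxF-upper a∈) (maxF-upper b∈) = ∈-⊕⁺ (∈-rev⁺ a∈) (∈-rev⁺ b∈)
    from : ∀ {x} → x ∈ rev A ⊕ rev B → x ∈ rev (A ⊕ B)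
    from q with ∈-⊕⁻ (rev A) q
    ... | _ , _ , a∈ , b∈ , refl with ∈-rev⁻ a∈ | ∈-rev⁻ b∈
    ...   | a , a∈A , refl | b , b∈B , refl = ∈-rev⁺′ (∈-⊕⁺ a∈A b∈B)
            (trans (sym ([m+n]∸[o+p]≡[m∸o]+[n∸p] (maxF-upper a∈A) (maxF-upper b∈B)))
                   (cong (_∸ (a + b)) (sym (maxF-⊕ zA zB))))

  ∈-rev-⊕ˡ : 0 ∈ A → 0 ∈ B → x ∈ rev A → x ∈ rev (A ⊕ B)
  ∈-rev-⊕ˡ zA zB p = ∈-≈⁻ (rev-⊕ zA zB) (∈-⊕ˡ p (0∈rev zB))

  ∈-rev-⊕ʳ : 0 ∈ A → 0 ∈ B → x ∈ rev B → x ∈ rev (A ⊕ B)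
  ∈-rev-⊕ʳ zA zB p = ∈-≈⁻ (rev-⊕ zA zB) (∈-⊕ʳ (0∈rev zA) p)

  -- Zero-sum blocks and (p + 1)-fold sumsets

  [m+n]%d≡m%d⇒d∣n : ∀ d .{{_ : NonZero d}} m n → (m + n) % d ≡ m % d → d ∣ n
  [m+n]%d≡m%d⇒d∣n d m n eq = divides (q₂ ∸ q₁) (begin
    n                                     ≡⟨ sym (m+n∸m≡n m n) ⟩
    (m + n) ∸ m                           ≡⟨ cong₂ _∸_ m+n≡ (m≡m%n+[m/n]*n m d) ⟩
    (m % d + q₂ * d) ∸ (m % d + q₁ * d)   ≡⟨ [m+n]∸[m+o]≡n∸o (m % d) (q₂ * d) (q₁ * d) ⟩
    q₂ * d ∸ q₁ * d                       ≡⟨ sym (*-distribʳ-∸ d q₂ q₁) ⟩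
    (q₂ ∸ q₁) * d                         ∎)
    where
    open ≡-Reasoning
    q₁ = m / d
    q₂ = (m + n) / d
    m+n≡ : m + n ≡ m % d + q₂ * d
    m+n≡ = trans (m≡m%n+[m/n]*n (m + n) d) (cong (_+ q₂ * d) eq)

  -- Pigeonhole on the e + 1 prefix sums modulo e.
  divisible-block : ∀ e .{{_ : NonZero e}} xs → e ≤ length xs →
                    ∃[ ys ] ∃[ zs ] ∃[ ws ] (xs ≡ ys ++ zs ++ ws × 1 ≤ length zs × e ∣ sum zs)
  divisible-block e xs e≤ with pigeonhole (s≤s e≤) (λ i → sum (take (toℕ i) xs) mod e)
  ... | i , j , i<j , same-residue = ys , zs , ws , split , nonempty , divisible
    where
    open ≡-Reasoning
    i′ = toℕ i
    j′ = toℕ j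
    ys = take i′ xs
    zs = drop i′ (take j′ xs)
    ws = drop j′ xs
    j≤ : j′ ≤ length xs
    j≤ = s≤s⁻¹ (toℕ<n j)
    prefix : take j′ xs ≡ ys ++ zs
    prefix = begin
      take j′ xs                          ≡⟨ sym (take++drop≡id i′ (take j′ xs)) ⟩
      take i′ (take j′ xs) ++ zs          ≡⟨ cong (_++ zs) (take-take i′ j′ xs) ⟩
      take (i′ ⊓ j′) xs ++ zs             ≡⟨ cong (λ k → take k xs ++ zs) (m≤n⇒m⊓n≡m (<⇒≤ i<j)) ⟩
      ys ++ zs                            ∎
    split : xs ≡ ys ++ zs ++ ws
    split = begin
      xs                      ≡⟨ sym (take++drop≡id j′ xs) ⟩
      take j′ xs ++ ws        ≡⟨ cong (_++ ws) prefix ⟩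
      (ys ++ zs) ++ ws        ≡⟨ ++-assoc ys zs ws ⟩
      ys ++ zs ++ ws          ∎
    nonempty : 1 ≤ length zs
    nonempty rewrite length-drop i′ (take j′ xs) | length-take j′ xs | m≤n⇒m⊓n≡m j≤ = m<n⇒0<n∸m i<j
    divisible : e ∣ sum zs
    divisible = [m+n]%d≡m%d⇒d∣n e (sum ys) (sum zs) (begin
      (sum ys + sum zs) % e          ≡⟨ cong (_% e) (sym (sum-++ ys zs)) ⟩
      sum (ys ++ zs) % e             ≡⟨ cong (λ l → sum l % e) (sym prefix) ⟩
      sum (take j′ xs) % e           ≡⟨ sym (toℕ-fromℕ< _) ⟩
      toℕ (sum (take j′ xs) mod e)   ≡⟨ cong toℕ (sym same-residue) ⟩
      toℕ (sum ys mod e)             ≡⟨ toℕ-fromℕ< _ ⟩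
      sum ys % e                     ∎)

  ∈·⇒sum : ∀ n → x ∈ n · E → ∃[ xs ] (length xs ≡ n × All (_∈ E) xs × sum xs ≡ x)
  ∈·⇒sum zero    (here refl) = [] , refl , [] , refl
  ∈·⇒sum {E = E} (suc n) p with ∈-⊕⁻ E p
  ... | a , b , a∈ , b∈ , refl with ∈·⇒sum n b∈
  ...   | xs , refl , all , refl = a ∷ xs , refl , a∈ ∷ all , refl

  sum∈· : ∀ {xs} → All (_∈ E) xs → sum xs ∈ length xs · E
  sum∈· []         = here refl
  sum∈· (x∈ ∷ all) = ∈-⊕⁺ x∈ (sum∈· all)

  ∈·-+ : ∀ {m n} → a ∈ m · E → b ∈ n · E → a + b ∈ (m + n) · E
  ∈·-+ {E = E} {m = m} {n = n} p q = ∈-≈⁻ (·-+ m n E) (∈-⊕⁺ p q)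

  *maxF∈· : ∀ {q n} → 0 ∈ E → q ≤ n → q * maxF E ∈ n · E
  *maxF∈· {q = zero}  {n}     z _         = 0∈· n z
  *maxF∈· {q = suc q} {suc n} z (s≤s q≤n) = ∈-⊕⁺ (maxF-∈ z) (*maxF∈· z q≤n)

  sum≤length* : ∀ {e} xs → All (_≤ e) xs → sum xs ≤ length xs * e
  sum≤length* []       []       = z≤n
  sum≤length* (x ∷ xs) (p ∷ ps) = +-mono-≤ p (sum≤length* xs ps)

  ∈·-+₃ : ∀ {c m n k} → a ∈ m · E → b ∈ n · E → c ∈ k · E → a + (b + c) ∈ (m + (n + k)) · E
  ∈·-+₃ {m = m} {n} {k} p q r = ∈·-+ {m = m} {n = n + k} p (∈·-+ {m = n} {n = k} q r)

  replace-block : ∀ {c m k ℓ q p} → 0 ∈ E → q ≤ suc ℓ → a ∈ m · E → c ∈ k · E →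
                  m + (ℓ + k) ≡ p → let x = a + (q * maxF E + c) in
                  x ∈ p · E ⊎ ∃[ z ] (z ∈ p · E × x ≡ maxF E + z)
  replace-block {m = m} {k} {ℓ} {zero} z _ a∈ c∈ refl = inj₁ (∈·-+₃ {m = m} {ℓ} {k} a∈ (0∈· ℓ z) c∈)
  replace-block {E = E} {a} {c} {m} {k} {ℓ} {suc r} z (s≤s r≤ℓ) a∈ c∈ refl =
    inj₂ (a + (r * maxF E + c) , ∈·-+₃ {m = m} {ℓ} {k} a∈ (*maxF∈· z r≤ℓ) c∈ , rearrange a (maxF E) (r * maxF E) c)
    where
    rearrange : ∀ a e r c → a + ((e + r) + c) ≡ e + (a + (r + c))
    rearrange = solve-∀

  -- Write x as a sum of p + 1 elements of E. Some block of summands adds up to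
  -- q · max E with q at most its length; replaced by q copies of max E and zeros,
  -- it leaves either a zero to drop or a summand max E to split off.
  suc·-split : ∀ {p} → 0 ∈ E → maxF E ≤ p → x ∈ suc p · E →
               x ∈ p · E ⊎ ∃[ z ] (z ∈ p · E × x ≡ maxF E + z)
  suc·-split {E} {p = p} z e≤p x∈ with ∈·⇒sum (suc p) x∈ | maxF E ≟ 0
  ... | xs , len , all , refl | yes e≡0 = inj₁ (subst (_∈ p · E) (sym sum≡0) (0∈· p z))
    where
    sum≡0 : sum xs ≡ 0
    sum≡0 = n≤0⇒n≡0 (subst (sum xs ≤_) (trans (cong (length xs *_) e≡0) (*-zeroʳ (length xs)))
                           (sum≤length* xs (All.map maxF-upper all)))
  ... | xs , len , all , refl | no e≢0
      with divisible-block (maxF E) {{≢-nonZero e≢0}} xs (≤-trans e≤p (≤-trans (n≤1+n p) (≤-reflexive (sym len))))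
  ... | ys , [] , ws , refl , () , _
  ... | ys , y ∷ zs , ws , refl , _ , divides q sum-block =
    subst (λ x → x ∈ p · E ⊎ ∃[ z ] (z ∈ p · E × x ≡ maxF E + z)) (sym sum-xs)
      (replace-block {m = length ys} {length ws} {length zs} z q≤ℓ
                     (sum∈· (++⁻ˡ ys all)) (sum∈· (++⁻ʳ (y ∷ zs) (++⁻ʳ ys all))) length-xs)
    where
    instance _ = ≢-nonZero e≢0
    sum-xs : sum (ys ++ (y ∷ zs) ++ ws) ≡ sum ys + (q * maxF E + sum ws)
    sum-xs = trans (sum-++ ys _) (cong (sum ys +_) (trans (sum-++ (y ∷ zs) ws) (cong (_+ sum ws) sum-block)))
    length-xs : length ys + (length zs + length ws) ≡ p
    length-xs = suc-injective (begin
      suc (length ys + (length zs + length ws))  ≡⟨ sym (+-suc (length ys) _) ⟩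
      length ys + suc (length zs + length ws)    ≡⟨ cong (length ys +_) (sym (length-++ (y ∷ zs))) ⟩
      length ys + length ((y ∷ zs) ++ ws)        ≡⟨ sym (length-++ ys) ⟩
      length (ys ++ (y ∷ zs) ++ ws)              ≡⟨ len ⟩
      suc p                                      ∎)
      where open ≡-Reasoning
    q≤ℓ : q ≤ suc (length zs)
    q≤ℓ = *-cancelʳ-≤ q (suc (length zs)) (maxF E)
            (subst (_≤ suc (length zs) * maxF E) sum-block
                   (sum≤length* (y ∷ zs) (All.map maxF-upper (++⁻ˡ (y ∷ zs) (++⁻ʳ ys all)))))

  shift-factorisation : ∀ k → 0 ∈ E → 0 ∈ B → maxF B + k ≡ maxF E →
                        (∀ {b} → b ∈ B → b ∈ E) → (∀ {b} → b ∈ B → b + k ∈ E) →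
                        (B ⊕ ((maxF E · E) ⊕ (0 ∷ k ∷ []))) ≈ (suc (maxF E) · E)
  shift-factorisation {E} {B} k zE zB max≡ B⊆E B+k⊆E = mk≈ to from
    where
    to : ∀ {x} → x ∈ B ⊕ ((maxF E · E) ⊕ (0 ∷ k ∷ [])) → x ∈ suc (maxF E) · E
    to r with ∈-⊕⁻ B r
    ... | b , _ , b∈ , c∈ , refl with ∈-⊕⁻ (maxF E · E) c∈
    ...   | y , .0 , y∈ , here refl , refl = ∈-⊕⁺′ (B⊆E b∈) y∈ (cong (b +_) (+-identityʳ y))
    ...   | y , .k , y∈ , there (here refl) , refl =
            ∈-⊕⁺′ (B+k⊆E b∈) y∈ (trans (cong (b +_) (+-comm y k)) (sym (+-assoc b k y)))
    from : ∀ {x} → x ∈ suc (maxF E) · E → x ∈ B ⊕ ((maxF E · E) ⊕ (0 ∷ k ∷ []))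
    from {x} r with suc·-split zE ≤-refl r
    ... | inj₁ x∈ = ∈-⊕ʳ zB (∈-⊕ˡ x∈ (here refl))
    ... | inj₂ (z , z∈ , refl) = ∈-⊕⁺′ (maxF-∈ zB) (∈-⊕⁺ z∈ (there (here refl)))
            (trans (cong (_+ z) (sym max≡)) (trans (+-assoc (maxF B) k z) (cong (maxF B +_) (+-comm k z))))

  -- Divisor-closed submonoids of Pfin0 S₁ ∩ rev (Pfin0 S₂)

  Pfin0Rev : NSet → NSet → FPred
  Pfin0Rev S₁ S₂ A = 0 ∈ A × All S₁ A × All S₂ (rev A)

  Pfin0∩revP≐Pfin0Rev : (Pfin0 S₁ ∩ revP (Pfin0 S₂)) ≐ Pfin0Rev S₁ S₂
  Pfin0∩revP≐Pfin0Rev = to , from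
    where
    to : (Pfin0 _ ∩ revP (Pfin0 _)) ⊆ Pfin0Rev _ _
    to A ((zA , all₁) , B , (zB , all₂) , A≈revB) =
      zA , all₁ , All-resp-⊇ (∈-≈⁺ (≈-trans (rev-cong A≈revB) (rev-involutive zB))) all₂
    from : Pfin0Rev _ _ ⊆ (Pfin0 _ ∩ revP (Pfin0 _))
    from A (zA , all₁ , all₂) = (zA , all₁) , rev A , (0∈rev zA , all₂) , ≈-sym (rev-involutive zA)

  All-⊕ : IsSubmonoidℕ S → All S A → All S B → All S (A ⊕ B)
  All-⊕ {S} {A} (_ , closed) p q = All.tabulate go
    where
    go : ∀ {x} → x ∈ A ⊕ _ → S x
    go r with ∈-⊕⁻ A r
    ... | a , b , a∈ , b∈ , refl = closed a b (All.lookup p a∈) (All.lookup q b∈)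

  Pfin0Rev-⊕ : IsSubmonoidℕ S₁ → IsSubmonoidℕ S₂ →
               Pfin0Rev S₁ S₂ A → Pfin0Rev S₁ S₂ B → Pfin0Rev S₁ S₂ (A ⊕ B)
  Pfin0Rev-⊕ s₁ s₂ (zA , all₁ , rev₁) (zB , all₂ , rev₂) =
    ∈-⊕⁺ zA zB , All-⊕ s₁ all₁ all₂ , All-resp-⊇ (∈-≈⁺ (rev-⊕ zA zB)) (All-⊕ s₂ rev₁ rev₂)

  Pfin0Rev-𝟘 : IsSubmonoidℕ S₁ → IsSubmonoidℕ S₂ → Pfin0Rev S₁ S₂ 𝟘
  Pfin0Rev-𝟘 (0∈S₁ , _) (0∈S₂ , _) = here refl , 0∈S₁ ∷ [] , 0∈S₂ ∷ []

  Pfin0Rev-· : ∀ n → IsSubmonoidℕ S₁ → IsSubmonoidℕ S₂ → Pfin0Rev S₁ S₂ A → Pfin0Rev S₁ S₂ (n · A)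
  Pfin0Rev-· zero    s₁ s₂ _ = Pfin0Rev-𝟘 s₁ s₂
  Pfin0Rev-· (suc n) s₁ s₂ p = Pfin0Rev-⊕ s₁ s₂ p (Pfin0Rev-· n s₁ s₂ p)

  Pfin0Rev-cong : A ≈ B → Pfin0Rev S₁ S₂ A → Pfin0Rev S₁ S₂ B
  Pfin0Rev-cong A≈B (zA , all₁ , all₂) =
    ∈-≈⁺ A≈B zA , All-resp-⊇ (∈-≈⁻ A≈B) all₁ , All-resp-⊇ (∈-≈⁻ (rev-cong A≈B)) all₂

  Pfin0Rev-mono : T₁ ⊆ₙ S₁ → T₂ ⊆ₙ S₂ → Pfin0Rev T₁ T₂ ⊆ Pfin0Rev S₁ S₂
  Pfin0Rev-mono T₁⊆S₁ T₂⊆S₂ A (zA , all₁ , all₂) = zA , All.map (T₁⊆S₁ _) all₁ , All.map (T₂⊆S₂ _) all₂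

  Pfin0Rev-cong₂ : S₁ ≐ₙ T₁ → S₂ ≐ₙ T₂ → Pfin0Rev S₁ S₂ ≐ Pfin0Rev T₁ T₂
  Pfin0Rev-cong₂ (f₁ , g₁) (f₂ , g₂) = Pfin0Rev-mono f₁ f₂ , Pfin0Rev-mono g₁ g₂

  Pfin0Rev-isDivisorClosed : IsSubmonoidℕ T₁ → IsSubmonoidℕ T₂ → T₁ ⊆ₙ S₁ → T₂ ⊆ₙ S₂ →
                             IsDivisorClosedSubmonoid (Pfin0Rev S₁ S₂) (Pfin0Rev T₁ T₂)
  Pfin0Rev-isDivisorClosed t₁ t₂ T₁⊆S₁ T₂⊆S₂ =
    (Pfin0Rev-mono T₁⊆S₁ T₂⊆S₂ , Pfin0Rev-𝟘 t₁ t₂ , (λ _ _ → Pfin0Rev-⊕ t₁ t₂) , (λ _ _ → Pfin0Rev-cong)) ,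
    divisors
    where
    divisors : ∀ B D → Pfin0Rev _ _ D → Divides (Pfin0Rev _ _) B D → Pfin0Rev _ _ B
    divisors B D (_ , all₁ , all₂) ((zB , _) , C , (zC , _) , D≈B⊕C) =
      zB , All-resp-⊇ (λ b∈ → ∈-≈⁻ D≈B⊕C (∈-⊕ˡ b∈ zC)) all₁ ,
      All-resp-⊇ (λ y∈ → ∈-≈⁻ (rev-cong D≈B⊕C) (∈-rev-⊕ˡ zB zC y∈)) all₂

  Elems : FPred → NSet
  Elems H x = ∃[ A ] (H A × x ∈ A)

  RevElems : FPred → NSet
  RevElems H y = ∃[ A ] (H A × y ∈ rev A)

  Elems-mono : H ⊆ K → Elems H ⊆ₙ Elems K
  Elems-mono H⊆K x (A , h , p) = A , H⊆K A h , p

  RevElems-mono : H ⊆ K → RevElems H ⊆ₙ RevElems K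
  RevElems-mono H⊆K y (A , h , p) = A , H⊆K A h , p

  b+[e∸β]≡a : ∀ {a b e β} → a ≤ e → b ≤ β → β ≤ e → β ∸ b ≡ e ∸ a → b + (e ∸ β) ≡ a
  b+[e∸β]≡a {a} {b} {e} {β} a≤e b≤β β≤e eq = +-cancelˡ-≡ (β ∸ b) _ _ (begin
    (β ∸ b) + (b + (e ∸ β))   ≡⟨ sym (+-assoc (β ∸ b) b (e ∸ β)) ⟩
    ((β ∸ b) + b) + (e ∸ β)   ≡⟨ cong (_+ (e ∸ β)) (m∸n+n≡m b≤β) ⟩
    β + (e ∸ β)               ≡⟨ m+[n∸m]≡n β≤e ⟩
    e                         ≡⟨ sym (m∸n+n≡m a≤e) ⟩
    (e ∸ a) + a               ≡⟨ cong (_+ a) (sym eq) ⟩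
    (β ∸ b) + a               ∎)
    where open ≡-Reasoning

  module DivisorClosed (s₁ : IsSubmonoidℕ S₁) (s₂ : IsSubmonoidℕ S₂) {H : FPred}
                       (dc : IsDivisorClosedSubmonoid (Pfin0Rev S₁ S₂) H) where

    H⊆Pfin0Rev : H ⊆ Pfin0Rev S₁ S₂
    H⊆Pfin0Rev = proj₁ (proj₁ dc)

    0∈ : H A → 0 ∈ A
    0∈ h = proj₁ (H⊆Pfin0Rev _ h)

    H-𝟘 : H 𝟘
    H-𝟘 = proj₁ (proj₂ (proj₁ dc))

    H-⊕ : H A → H B → H (A ⊕ B)
    H-⊕ = proj₁ (proj₂ (proj₂ (proj₁ dc))) _ _

    H-· : ∀ n → H A → H (n · A)
    H-· zero    h = H-𝟘
    H-· (suc n) h = H-⊕ h (H-· n h)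

    Elems-isSubmonoid : IsSubmonoidℕ (Elems H)
    Elems-isSubmonoid = (𝟘 , H-𝟘 , here refl) ,
      λ { _ _ (A , h , p) (A′ , h′ , q) → A ⊕ A′ , H-⊕ h h′ , ∈-⊕⁺ p q }

    RevElems-isSubmonoid : IsSubmonoidℕ (RevElems H)
    RevElems-isSubmonoid = (𝟘 , H-𝟘 , here refl) ,
      λ { _ _ (A , h , p) (A′ , h′ , q) → A ⊕ A′ , H-⊕ h h′ , ∈-≈⁻ (rev-⊕ (0∈ h) (0∈ h′)) (∈-⊕⁺ p q) }

    Elems⊆ : Elems H ⊆ₙ S₁
    Elems⊆ x (A , h , p) = All.lookup (proj₁ (proj₂ (H⊆Pfin0Rev A h))) p

    RevElems⊆ : RevElems H ⊆ₙ S₂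
    RevElems⊆ y (A , h , p) = All.lookup (proj₂ (proj₂ (H⊆Pfin0Rev A h))) p

    common-witness : ∀ (f : ℕ → ℕ) xs → (∀ {b} → b ∈ xs → Elems H b × RevElems H (f b)) →
                     ∃[ E ] (H E × (∀ {b} → b ∈ xs → b ∈ E × f b ∈ rev E))
    common-witness f []       _ = 𝟘 , H-𝟘 , λ ()
    common-witness f (b ∷ xs) w with w (here refl) | common-witness f xs (λ p → w (there p))
    ... | (A , hA , b∈A) , (A′ , hA′ , fb∈) | E′ , hE′ , both =
      A ⊕ (A′ ⊕ E′) , H-⊕ hA (H-⊕ hA′ hE′) , both′
      where
      zA : 0 ∈ A
      zA = 0∈ hA
      zR : 0 ∈ A′ ⊕ E′
      zR = ∈-⊕⁺ (0∈ hA′) (0∈ hE′)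
      both′ : ∀ {c} → c ∈ b ∷ xs → c ∈ A ⊕ (A′ ⊕ E′) × f c ∈ rev (A ⊕ (A′ ⊕ E′))
      both′ (here refl) = ∈-⊕ˡ b∈A zR , ∈-rev-⊕ʳ zA zR (∈-rev-⊕ˡ (0∈ hA′) (0∈ hE′) fb∈)
      both′ (there p)   = ∈-⊕ʳ zA (∈-⊕ʳ (0∈ hA′) (proj₁ (both p))) ,
                          ∈-rev-⊕ʳ zA zR (∈-rev-⊕ʳ (0∈ hA′) (0∈ hE′) (proj₂ (both p)))

    -- B divides (max E + 1) · E for a set E ∈ H that contains B and the shift B + k,
    -- k = max E ∸ max B; such an E exists when B ⊆ Elems H and rev B ⊆ RevElems H.
    Pfin0Rev-Elems⊆ : Pfin0Rev (Elems H) (RevElems H) ⊆ H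
    Pfin0Rev-Elems⊆ B pB@(zB , elems , revElems) with
      common-witness (maxF B ∸_) B (λ p → All.lookup elems p , All.lookup revElems (∈-rev⁺ p))
    ... | E , hE , both =
      proj₂ dc B (suc e · E) (H-· (suc e) hE) (mB , cofactor , m-cofactor , ≈-sym factorisation)
      where
      e β k : ℕ
      e = maxF E
      β = maxF B
      k = e ∸ β
      mE : Pfin0Rev S₁ S₂ E
      mE = H⊆Pfin0Rev E hE
      mB : Pfin0Rev S₁ S₂ B
      mB = Pfin0Rev-mono Elems⊆ RevElems⊆ B pB
      β≤e : β ≤ e
      β≤e = maxF-upper (proj₁ (both (maxF-∈ zB)))
      B+k⊆E : ∀ {b} → b ∈ B → b + k ∈ E
      B+k⊆E {b} p with ∈-rev⁻ (proj₂ (both p))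
      ... | a , a∈ , eq = subst (_∈ E) (sym (b+[e∸β]≡a (maxF-upper a∈) (maxF-upper p) β≤e eq)) a∈
      m0k : Pfin0Rev S₁ S₂ (0 ∷ k ∷ [])
      m0k = here refl , proj₁ s₁ ∷ All.lookup (proj₁ (proj₂ mE)) (B+k⊆E zB) ∷ [] ,
            subst S₂ (sym (⊔-identityʳ k)) (All.lookup (proj₂ (proj₂ mE)) (∈-rev⁺ (proj₁ (both (maxF-∈ zB))))) ∷
            subst S₂ (sym (trans (cong (_∸ k) (⊔-identityʳ k)) (n∸n≡0 k))) (proj₁ s₂) ∷ []
      cofactor : FSet
      cofactor = (e · E) ⊕ (0 ∷ k ∷ [])
      m-cofactor : Pfin0Rev S₁ S₂ cofactor
      m-cofactor = Pfin0Rev-⊕ s₁ s₂ (Pfin0Rev-· e s₁ s₂ mE) m0k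
      factorisation : (B ⊕ cofactor) ≈ (suc e · E)
      factorisation = shift-factorisation k (proj₁ mE) zB (m+[n∸m]≡n β≤e) (λ p → proj₁ (both p)) B+k⊆E

    ≐Pfin0Rev : H ≐ Pfin0Rev (Elems H) (RevElems H)
    ≐Pfin0Rev = (λ A h → 0∈ h , All.tabulate (λ p → A , h , p) , All.tabulate (λ p → A , h , p)) ,
                Pfin0Rev-Elems⊆

  -- Submonoids of ℕ₀

  least : ExcludedMiddle 0ℓ → (P : ℕ → Set) → P x → ∃[ w ] (P w × (∀ y → y < w → ¬ P y))
  least {x} em P = <-rec (λ x → P x → ∃[ w ] (P w × (∀ y → y < w → ¬ P y))) step x
    where
    step : ∀ x → (∀ {y} → y < x → P y → ∃[ w ] (P w × (∀ y → y < w → ¬ P y))) →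
           P x → ∃[ w ] (P w × (∀ y → y < w → ¬ P y))
    step x rec px with em {∃[ y ] (y < x × P y)}
    ... | yes (y , y<x , py) = rec y<x py
    ... | no none            = x , px , λ y y<x py → none (y , y<x , py)

  *-closed : IsSubmonoidℕ S → S a → ∀ q → S (q * a)
  *-closed (0∈S , _)      _  zero    = 0∈S
  *-closed s@(_ , closed) sa (suc q) = closed _ _ sa (*-closed s sa q)

  contains-1⇒total : IsSubmonoidℕ S → S 1 → ∀ n → S n
  contains-1⇒total {S} s s1 n = subst S (*-identityʳ n) (*-closed s s1 n)

  IsAtom : NSet → ℕ → Set
  IsAtom S a = S a × a ≢ 0 × (∀ y z → S y → S z → a ≡ y + z → y ≡ 0 ⊎ z ≡ 0)

  -- Split x into two nonzero summands of S while possible, keeping a summand outside T.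
  atom-outside : ExcludedMiddle 0ℓ → IsSubmonoidℕ T₁ → S x → ¬ T₁ x → ∃[ a ] (IsAtom S a × ¬ T₁ a)
  atom-outside {T₁ = T} {S} {x} em (0∈T , closed) = <-rec Goal step x
    where
    Goal : ℕ → Set
    Goal x = S x → ¬ T x → ∃[ a ] (IsAtom S a × ¬ T a)
    step : ∀ x → (∀ {y} → y < x → Goal y) → Goal x
    step x rec sx x∉T with em {∃[ y ] ∃[ z ] (S y × S z × y ≢ 0 × z ≢ 0 × x ≡ y + z)}
    ... | yes (y , z , sy , sz , y≢0 , z≢0 , refl) with em {T y}
    ...   | yes y∈T = rec (m<n+m z (n≢0⇒n>0 y≢0)) sz (λ z∈T → x∉T (closed y z y∈T z∈T))
    ...   | no  y∉T = rec (m<m+n y (n≢0⇒n>0 z≢0)) sy y∉T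
    step x rec sx x∉T | no unsplittable = x , (sx , x≢0 , split) , x∉T
      where
      x≢0 : x ≢ 0
      x≢0 refl = x∉T 0∈T
      split : ∀ y z → S y → S z → x ≡ y + z → y ≡ 0 ⊎ z ≡ 0
      split y z sy sz eq with y ≟ 0 | z ≟ 0
      ... | yes y≡0 | _        = inj₁ y≡0
      ... | no _    | yes z≡0  = inj₂ z≡0
      ... | no y≢0  | no z≢0   = ⊥-elim (unsplittable (y , z , sy , sz , y≢0 , z≢0 , eq))

  without : NSet → ℕ → NSet
  without S a y = S y × y ≢ a

  without-isMaxProper : ExcludedMiddle 0ℓ → IsSubmonoidℕ S → IsAtom S a →
                        IsMaxProperSubmonoid S (without S a)
  without-isMaxProper {S} {a} em (0∈S , closed) (sa , a≢0 , split) =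
    ((0∈S , λ 0≡a → a≢0 (sym 0≡a)) , closed′) , (λ _ → proj₁) , (a , sa , λ p → proj₂ p refl) , maximal
    where
    closed′ : ∀ m n → without S a m → without S a n → without S a (m + n)
    closed′ m n (sm , m≢a) (sn , n≢a) = closed m n sm sn , λ eq → m+n≢a (split m n sm sn (sym eq)) eq
      where
      m+n≢a : (m ≡ 0 ⊎ n ≡ 0) → m + n ≢ a
      m+n≢a (inj₁ refl) eq = n≢a eq
      m+n≢a (inj₂ refl) eq = m≢a (trans (sym (+-identityʳ m)) eq)
    maximal : ∀ T → IsSubmonoidℕ T → without S a ⊆ₙ T → T ⊆ₙ S → (T ⊆ₙ without S a) ⊎ (S ⊆ₙ T)
    maximal T _ S∖a⊆T T⊆S with em {T a}
    ... | no  a∉T = inj₁ λ y ty → T⊆S y ty , λ { refl → a∉T ty }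
    ... | yes a∈T = inj₂ S⊆T
      where
      S⊆T : S ⊆ₙ T
      S⊆T y sy with y ≟ a
      ... | yes refl = a∈T
      ... | no  y≢a  = S∖a⊆T y (sy , y≢a)

  Cofinite : NSet → Set
  Cofinite S = ∃[ F ] (∀ n → F ≤ n → S n)

  -- n = r + q b with r < b ≤ q is a sum of (q ∸ r) copies of b and r copies of b + 1.
  consecutive⇒cofinite : IsSubmonoidℕ S → S b → S (suc b) → Cofinite S
  consecutive⇒cofinite {S} {zero}      s _  s1 = 0 , λ n _ → contains-1⇒total s s1 n
  consecutive⇒cofinite {S} {b@(suc _)} s sb sb+1 = b * b , large
    where
    large : ∀ n → b * b ≤ n → S n
    large n b*b≤n = subst S (sym n≡) (proj₂ s _ _ (*-closed s sb (q ∸ r)) (*-closed s sb+1 r))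
      where
      q = n / b
      r = n % b
      n≡r+qb : n ≡ r + q * b
      n≡r+qb = m≡m%n+[m/n]*n n b
      b≤q : b ≤ q
      b≤q with b ≤? q
      ... | yes b≤q = b≤q
      ... | no  b≰q = ⊥-elim (<⇒≱ n<b*b b*b≤n)
        where
        open ≤-Reasoning
        n<b*b : n < b * b
        n<b*b = begin-strict
          n          ≡⟨ n≡r+qb ⟩
          r + q * b  <⟨ +-monoˡ-< (q * b) (m%n<n n b) ⟩
          suc q * b  ≤⟨ *-monoˡ-≤ b (≰⇒> b≰q) ⟩
          b * b      ∎
      r≤q : r ≤ q
      r≤q = ≤-trans (<⇒≤ (m%n<n n b)) b≤q
      n≡ : n ≡ (q ∸ r) * b + r * suc b
      n≡ = begin
        n                          ≡⟨ n≡r+qb ⟩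
        r + q * b                  ≡⟨ cong (λ t → r + t * b) (sym (m∸n+n≡m r≤q)) ⟩
        r + ((q ∸ r) + r) * b      ≡⟨ regroup r (q ∸ r) b ⟩
        (q ∸ r) * b + r * suc b    ∎
        where
        open ≡-Reasoning
        regroup : ∀ x y z → x + (y + x) * z ≡ y * z + x * suc z
        regroup = solve-∀

  -- The least positive difference g of two elements divides every element,
  -- since the remainder modulo g is again such a difference.
  numerical⇒consecutive : ExcludedMiddle 0ℓ → IsNumericalMonoid S → ∃[ b ] (S b × S (suc b))
  numerical⇒consecutive {S} em (s@(0∈S , closed) , gcd≡1) with em {∃[ x ] (S x × x ≢ 0)}
  ... | no  trivial         = ⊥-elim (2≢1 (gcd≡1 2 2∣))
    where
    2≢1 : 2 ≢ 1
    2≢1 ()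
    2∣ : ∀ x → S x → 2 ∣ x
    2∣ x sx with x ≟ 0
    ... | yes refl = divides 0 refl
    ... | no  x≢0  = ⊥-elim (trivial (x , sx , x≢0))
  ... | yes (x , sx , x≢0) with least em PositiveGap ((x , 0 , sx , 0∈S , refl) , n≢0⇒n>0 x≢0)
    where
    PositiveGap : ℕ → Set
    PositiveGap g = (∃[ a ] ∃[ b ] (S a × S b × a ≡ b + g)) × 1 ≤ g
  ...   | g , ((a , b , sa , sb , a≡b+g) , 1≤g) , minimal =
          b , sb , subst S (trans a≡b+g (trans (cong (b +_) g≡1) (+-comm b 1))) sa
    where
    instance _ = >-nonZero 1≤g
    g∣ : ∀ y → S y → g ∣ y
    g∣ y sy with y % g ≟ 0
    ... | yes r≡0 = divides (y / g) (trans (m≡m%n+[m/n]*n y g) (cong (_+ y / g * g) r≡0))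
    ... | no  r≢0 = ⊥-elim (minimal r (m%n<n y g)
                      ((y + q * b , q * a , closed _ _ sy (*-closed s sb q) , *-closed s sa q , gap) , n≢0⇒n>0 r≢0))
      where
      open ≡-Reasoning
      q = y / g
      r = y % g
      gap : y + q * b ≡ q * a + r
      gap = begin
        y + q * b            ≡⟨ cong (_+ q * b) (m≡m%n+[m/n]*n y g) ⟩
        (r + q * g) + q * b  ≡⟨ regroup r (q * g) (q * b) ⟩
        (q * b + q * g) + r  ≡⟨ cong (_+ r) (sym (*-distribˡ-+ q b g)) ⟩
        q * (b + g) + r      ≡⟨ cong (λ t → q * t + r) (sym a≡b+g) ⟩
        q * a + r            ∎
        where
        regroup : ∀ x y z → (x + y) + z ≡ (z + y) + x
        regroup = solve-∀
    g≡1 : g ≡ 1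
    g≡1 = gcd≡1 g g∣

  numerical⇒cofinite : ExcludedMiddle 0ℓ → IsNumericalMonoid S → Cofinite S
  numerical⇒cofinite em n with numerical⇒consecutive em n
  ... | b , sb , sb+1 = consecutive⇒cofinite (proj₁ n) sb sb+1

  -- Adding to S′ all elements of S above some x ∉ S′ gives a submonoid strictly
  -- between S′ and S unless S′ already contains them.
  maxProper-cofinite : IsSubmonoidℕ S → Cofinite S → IsMaxProperSubmonoid S S′ → Cofinite S′
  maxProper-cofinite {S} {S′} (_ , closed) (F , large) ((0∈S′ , closed′) , S′⊆S , (x , sx , x∉S′) , maximal)
    with maximal T (inj₁ 0∈S′ , T-closed) (λ _ → inj₁) T⊆S
    where
    T : NSet
    T y = S′ y ⊎ (S y × x < y)
    T⊆S : T ⊆ₙ S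
    T⊆S y (inj₁ p)       = S′⊆S y p
    T⊆S y (inj₂ (p , _)) = p
    T-closed : ∀ m n → T m → T n → T (m + n)
    T-closed m n (inj₁ p) (inj₁ q)       = inj₁ (closed′ m n p q)
    T-closed m n (inj₁ p) (inj₂ (q , l)) = inj₂ (closed m n (S′⊆S m p) q , ≤-trans l (m≤n+m n m))
    T-closed m n (inj₂ (p , l)) t        = inj₂ (closed m n p (T⊆S n t) , ≤-trans l (m≤m+n m n))
  ... | inj₁ T⊆S′ = F + suc x , λ n F+x<n →
          T⊆S′ n (inj₂ (large n (≤-trans (m≤m+n F (suc x)) F+x<n) , ≤-trans (m≤n+m (suc x) F) F+x<n))
  ... | inj₂ S⊆T with S⊆T x sx
  ...   | inj₁ x∈S′      = ⊥-elim (x∉S′ x∈S′)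
  ...   | inj₂ (_ , x<x) = ⊥-elim (<-irrefl refl x<x)

  -- Maximal divisor-closed submonoids

  triangle : ℕ → ℕ → FSet
  triangle x y = 0 ∷ x ∷ x + y ∷ []

  maxF-triangle : ∀ x y → maxF (triangle x y) ≡ x + y
  maxF-triangle x y = maxF-unique (there (there (here refl))) bound
    where
    bound : ∀ {z} → z ∈ triangle x y → z ≤ x + y
    bound (here refl)                 = z≤n
    bound (there (here refl))         = m≤m+n x y
    bound (there (there (here refl))) = ≤-refl

  y∈rev-triangle : ∀ x y → y ∈ rev (triangle x y)
  y∈rev-triangle x y = ∈-rev⁺′ {A = triangle x y} (there (here refl))
                         (sym (trans (cong (_∸ x) (maxF-triangle x y)) (m+n∸m≡n x y)))

  triangle∈Pfin0Rev : ∀ {x y} → IsSubmonoidℕ T₁ → IsSubmonoidℕ T₂ →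
                      T₁ x → T₁ (x + y) → T₂ y → T₂ (x + y) → Pfin0Rev T₁ T₂ (triangle x y)
  triangle∈Pfin0Rev {T₂ = T₂} {x} {y} (0∈T₁ , _) (0∈T₂ , _) x∈T₁ x+y∈T₁ y∈T₂ x+y∈T₂ =
    here refl , 0∈T₁ ∷ x∈T₁ ∷ x+y∈T₁ ∷ [] ,
    subst (λ m → All T₂ (m ∷ m ∸ x ∷ m ∸ (x + y) ∷ [])) (sym (maxF-triangle x y))
          (x+y∈T₂ ∷ subst T₂ (sym (m+n∸m≡n x y)) y∈T₂ ∷ subst T₂ (sym (n∸n≡0 (x + y))) 0∈T₂ ∷ [])

  Cofinite₂ : NSet → NSet → Set
  Cofinite₂ T₁ T₂ = ∃[ F ] (∀ n → F ≤ n → T₁ n × T₂ n)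

  cofinite₂ : Cofinite T₁ → Cofinite T₂ → Cofinite₂ T₁ T₂
  cofinite₂ (F₁ , large₁) (F₂ , large₂) =
    F₁ + F₂ , λ n F≤n → large₁ n (≤-trans (m≤m+n F₁ F₂) F≤n) , large₂ n (≤-trans (m≤n+m F₂ F₁) F≤n)

  ⊆Elems-Pfin0Rev : IsSubmonoidℕ T₁ → IsSubmonoidℕ T₂ → Cofinite₂ T₁ T₂ → T₁ ⊆ₙ Elems (Pfin0Rev T₁ T₂)
  ⊆Elems-Pfin0Rev t₁ t₂ (F , large) x x∈T₁ =
    triangle x F , triangle∈Pfin0Rev t₁ t₂ x∈T₁ (proj₁ x+F) (proj₂ (large F ≤-refl)) (proj₂ x+F) ,
    there (here refl)
    where x+F = large (x + F) (m≤n+m F x)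

  ⊆RevElems-Pfin0Rev : IsSubmonoidℕ T₁ → IsSubmonoidℕ T₂ → Cofinite₂ T₁ T₂ → T₂ ⊆ₙ RevElems (Pfin0Rev T₁ T₂)
  ⊆RevElems-Pfin0Rev t₁ t₂ (F , large) y y∈T₂ =
    triangle F y , triangle∈Pfin0Rev t₁ t₂ (proj₁ (large F ≤-refl)) (proj₁ F+y) y∈T₂ (proj₂ F+y) ,
    y∈rev-triangle F y
    where F+y = large (F + y) (m≤m+n F y)

  ≐-sym : H ≐ K → K ≐ H
  ≐-sym (f , g) = g , f

  ≐-trans : H ≐ K → K ≐ M → H ≐ M
  ≐-trans (f , g) (f′ , g′) = (λ A h → f′ A (f A h)) , (λ A h → g A (g′ A h))

  Divides-respˡ : M ≐ M′ → Divides M B D → Divides M′ B D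
  Divides-respˡ (f , _) (mB , C , mC , eq) = f _ mB , C , f _ mC , eq

  IsDivisorClosedSubmonoid-respˡ : M ≐ M′ → IsDivisorClosedSubmonoid M H → IsDivisorClosedSubmonoid M′ H
  IsDivisorClosedSubmonoid-respˡ M≐M′ ((H⊆M , h𝟘 , h⊕ , h≈) , divisors) =
    ((λ A h → proj₁ M≐M′ A (H⊆M A h)) , h𝟘 , h⊕ , h≈) ,
    λ B D h d → divisors B D h (Divides-respˡ (≐-sym M≐M′) d)

  IsProper-respˡ : M ≐ M′ → IsProper M H → IsProper M′ H
  IsProper-respˡ (f , _) (A , mA , A∉H) = A , f A mA , A∉H

  IsMaxDivisorClosed-respˡ : M ≐ M′ → IsMaxDivisorClosed M H → IsMaxDivisorClosed M′ H
  IsMaxDivisorClosed-respˡ M≐M′ (dc , proper , maximal) =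
    IsDivisorClosedSubmonoid-respˡ M≐M′ dc , IsProper-respˡ M≐M′ proper ,
    λ K dcK properK →
      maximal K (IsDivisorClosedSubmonoid-respˡ (≐-sym M≐M′) dcK) (IsProper-respˡ (≐-sym M≐M′) properK)

  IsDivisorClosedSubmonoid-respʳ : H ≐ K → IsDivisorClosedSubmonoid M H → IsDivisorClosedSubmonoid M K
  IsDivisorClosedSubmonoid-respʳ (f , g) ((H⊆M , h𝟘 , h⊕ , h≈) , divisors) =
    ((λ A k → H⊆M A (g A k)) , f _ h𝟘 , (λ A B a b → f _ (h⊕ A B (g A a) (g B b))) ,
     (λ A B eq a → f B (h≈ A B eq (g A a)))) ,
    λ B D k d → f B (divisors B D (g D k) d)

  IsMaxDivisorClosed-respʳ : H ≐ K → IsMaxDivisorClosed M H → IsMaxDivisorClosed M K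
  IsMaxDivisorClosed-respʳ H≐K@(f , g) (dc , (A , mA , A∉H) , maximal) =
    IsDivisorClosedSubmonoid-respʳ H≐K dc , (A , mA , λ k → A∉H (g A k)) ,
    λ K′ dcK′ properK′ K⊆K′ A k′ → f A (maximal K′ dcK′ properK′ (λ B h → K⊆K′ B (f B h)) A k′)

  counterexample : ExcludedMiddle 0ℓ → ∀ {P : ℕ → Set} xs → ¬ All P xs → ∃[ b ] (b ∈ xs × ¬ P b)
  counterexample em xs ¬all = find (¬All⇒Any¬ (λ _ → em) xs ¬all)

  module MaximalDivisorClosed (em : ExcludedMiddle 0ℓ) (n₁ : IsNumericalMonoid S₁) (n₂ : IsNumericalMonoid S₂) where

    s₁ : IsSubmonoidℕ S₁
    s₁ = proj₁ n₁
    s₂ : IsSubmonoidℕ S₂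
    s₂ = proj₁ n₂

    OfMaxSubmonoidˡ OfMaxSubmonoidʳ : FPred → Set₁
    OfMaxSubmonoidˡ H = ∃[ S₁′ ] (IsMaxProperSubmonoid S₁ S₁′ × (H ≐ Pfin0Rev S₁′ S₂))
    OfMaxSubmonoidʳ H = ∃[ S₂′ ] (IsMaxProperSubmonoid S₂ S₂′ × (H ≐ Pfin0Rev S₁ S₂′))

    cofinite-S₁S₂ : Cofinite₂ S₁ S₂
    cofinite-S₁S₂ = cofinite₂ (numerical⇒cofinite em n₁) (numerical⇒cofinite em n₂)

    properˡ : T₁ ⊆ₙ S₁ → S₁ x → ¬ T₁ x → IsProper (Pfin0Rev S₁ S₂) (Pfin0Rev T₁ S₂)
    properˡ T₁⊆S₁ sx x∉T₁ with ⊆Elems-Pfin0Rev s₁ s₂ cofinite-S₁S₂ _ sx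
    ... | A , mA , x∈A = A , mA , λ a → x∉T₁ (All.lookup (proj₁ (proj₂ a)) x∈A)

    properʳ : T₂ ⊆ₙ S₂ → S₂ x → ¬ T₂ x → IsProper (Pfin0Rev S₁ S₂) (Pfin0Rev S₁ T₂)
    properʳ T₂⊆S₂ sx x∉T₂ with ⊆RevElems-Pfin0Rev s₁ s₂ cofinite-S₁S₂ _ sx
    ... | A , mA , x∈revA = A , mA , λ a → x∉T₂ (All.lookup (proj₂ (proj₂ a)) x∈revA)

    full⇒improper : IsDivisorClosedSubmonoid (Pfin0Rev S₁ S₂) K → S₁ ⊆ₙ Elems K → S₂ ⊆ₙ RevElems K →
                    ¬ IsProper (Pfin0Rev S₁ S₂) K
    full⇒improper dc S₁⊆ S₂⊆ (A , (zA , all₁ , all₂) , A∉K) =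
      A∉K (DivisorClosed.Pfin0Rev-Elems⊆ s₁ s₂ dc A (zA , All.map (S₁⊆ _) all₁ , All.map (S₂⊆ _) all₂))

    maximal-⊆⇒≐ : IsMaxDivisorClosed (Pfin0Rev S₁ S₂) H → IsDivisorClosedSubmonoid (Pfin0Rev S₁ S₂) K →
                  IsProper (Pfin0Rev S₁ S₂) K → H ⊆ K → H ≐ K
    maximal-⊆⇒≐ (_ , _ , maximal) dcK properK H⊆K = H⊆K , maximal _ dcK properK H⊆K

    -- Removing an atom of S₁ that Elems H misses gives a larger proper divisor-closed submonoid.
    missing-elementˡ : IsMaxDivisorClosed (Pfin0Rev S₁ S₂) H → S₁ b → ¬ Elems H b → OfMaxSubmonoidˡ H
    missing-elementˡ {H} maxH@(dc , _) sb b∉ with atom-outside em Elems-isSubmonoid sb b∉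
      where open DivisorClosed s₁ s₂ dc
    ... | a , atom , a∉ = without S₁ a , max-without , maximal-⊆⇒≐ maxH dc-without proper-without H⊆
      where
      open DivisorClosed s₁ s₂ dc
      max-without : IsMaxProperSubmonoid S₁ (without S₁ a)
      max-without = without-isMaxProper em s₁ atom
      dc-without : IsDivisorClosedSubmonoid (Pfin0Rev S₁ S₂) (Pfin0Rev (without S₁ a) S₂)
      dc-without = Pfin0Rev-isDivisorClosed (proj₁ max-without) s₂ (λ _ → proj₁) (λ _ p → p)
      proper-without : IsProper (Pfin0Rev S₁ S₂) (Pfin0Rev (without S₁ a) S₂)
      proper-without = properˡ (λ _ → proj₁) (proj₁ atom) (λ p → proj₂ p refl)
      H⊆ : H ⊆ Pfin0Rev (without S₁ a) S₂
      H⊆ B h = Pfin0Rev-mono (λ x p → Elems⊆ x p , λ { refl → a∉ p }) RevElems⊆ B (proj₁ ≐Pfin0Rev B h)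

    missing-elementʳ : IsMaxDivisorClosed (Pfin0Rev S₁ S₂) H → S₂ b → ¬ RevElems H b → OfMaxSubmonoidʳ H
    missing-elementʳ {H} maxH@(dc , _) sb b∉ with atom-outside em RevElems-isSubmonoid sb b∉
      where open DivisorClosed s₁ s₂ dc
    ... | a , atom , a∉ = without S₂ a , max-without , maximal-⊆⇒≐ maxH dc-without proper-without H⊆
      where
      open DivisorClosed s₁ s₂ dc
      max-without : IsMaxProperSubmonoid S₂ (without S₂ a)
      max-without = without-isMaxProper em s₂ atom
      dc-without : IsDivisorClosedSubmonoid (Pfin0Rev S₁ S₂) (Pfin0Rev S₁ (without S₂ a))
      dc-without = Pfin0Rev-isDivisorClosed s₁ (proj₁ max-without) (λ _ p → p) (λ _ → proj₁)
      proper-without : IsProper (Pfin0Rev S₁ S₂) (Pfin0Rev S₁ (without S₂ a))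
      proper-without = properʳ (λ _ → proj₁) (proj₁ atom) (λ p → proj₂ p refl)
      H⊆ : H ⊆ Pfin0Rev S₁ (without S₂ a)
      H⊆ B h = Pfin0Rev-mono Elems⊆ (λ y p → RevElems⊆ y p , λ { refl → a∉ p }) B (proj₁ ≐Pfin0Rev B h)

    -- By the classification, a set missing from H has an element outside Elems H
    -- or a reflected element outside RevElems H.
    maximal⇒OfMaxSubmonoid : IsMaxDivisorClosed (Pfin0Rev S₁ S₂) H → OfMaxSubmonoidˡ H ⊎ OfMaxSubmonoidʳ H
    maximal⇒OfMaxSubmonoid {H} maxH@(dc , (A , (zA , all₁ , all₂) , A∉H) , _)
      with em {All (Elems H) A} | em {All (RevElems H) (rev A)}
    ... | yes all | yes rall = ⊥-elim (A∉H (DivisorClosed.Pfin0Rev-Elems⊆ s₁ s₂ dc A (zA , all , rall)))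
    ... | no ¬all | _ with counterexample em A ¬all
    ...   | b , b∈A , b∉ = inj₁ (missing-elementˡ maxH (All.lookup all₁ b∈A) b∉)
    maximal⇒OfMaxSubmonoid maxH@(_ , (A , (_ , _ , all₂) , _) , _) | _ | no ¬rall
      with counterexample em (rev A) ¬rall
    ...   | b , b∈revA , b∉ = inj₂ (missing-elementʳ maxH (All.lookup all₂ b∈revA) b∉)

    -- A divisor-closed K ⊇ Pfin0Rev T₁ S₂ has Elems K ⊇ T₁ and RevElems K ⊇ S₂, so by
    -- maximality of T₁ it is either below Pfin0Rev T₁ S₂ or everything.
    maximalˡ : IsMaxProperSubmonoid S₁ T₁ → IsMaxDivisorClosed (Pfin0Rev S₁ S₂) (Pfin0Rev T₁ S₂)
    maximalˡ {T₁} maxT₁@(t₁ , T₁⊆S₁ , (x , sx , x∉T₁) , maxi) =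
      Pfin0Rev-isDivisorClosed t₁ s₂ T₁⊆S₁ (λ _ p → p) , properˡ T₁⊆S₁ sx x∉T₁ , maximal
      where
      cofinite : Cofinite₂ T₁ S₂
      cofinite = cofinite₂ (maxProper-cofinite s₁ (numerical⇒cofinite em n₁) maxT₁) (numerical⇒cofinite em n₂)
      maximal : ∀ K → IsDivisorClosedSubmonoid (Pfin0Rev S₁ S₂) K → IsProper (Pfin0Rev S₁ S₂) K →
                Pfin0Rev T₁ S₂ ⊆ K → K ⊆ Pfin0Rev T₁ S₂
      maximal K dc properK below⊆K
        with maxi (Elems K) Elems-isSubmonoid
                  (λ y p → Elems-mono below⊆K y (⊆Elems-Pfin0Rev t₁ s₂ cofinite y p)) Elems⊆
        where open DivisorClosed s₁ s₂ dc
      ... | inj₂ S₁⊆ = ⊥-elim (full⇒improper dc S₁⊆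
                                 (λ y p → RevElems-mono below⊆K y (⊆RevElems-Pfin0Rev t₁ s₂ cofinite y p)) properK)
      ... | inj₁ ⊆T₁ = λ A k → Pfin0Rev-mono ⊆T₁ RevElems⊆ A (proj₁ ≐Pfin0Rev A k)
        where open DivisorClosed s₁ s₂ dc

    maximalʳ : IsMaxProperSubmonoid S₂ T₂ → IsMaxDivisorClosed (Pfin0Rev S₁ S₂) (Pfin0Rev S₁ T₂)
    maximalʳ {T₂} maxT₂@(t₂ , T₂⊆S₂ , (x , sx , x∉T₂) , maxi) =
      Pfin0Rev-isDivisorClosed s₁ t₂ (λ _ p → p) T₂⊆S₂ , properʳ T₂⊆S₂ sx x∉T₂ , maximal
      where
      cofinite : Cofinite₂ S₁ T₂
      cofinite = cofinite₂ (numerical⇒cofinite em n₁) (maxProper-cofinite s₂ (numerical⇒cofinite em n₂) maxT₂)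
      maximal : ∀ K → IsDivisorClosedSubmonoid (Pfin0Rev S₁ S₂) K → IsProper (Pfin0Rev S₁ S₂) K →
                Pfin0Rev S₁ T₂ ⊆ K → K ⊆ Pfin0Rev S₁ T₂
      maximal K dc properK below⊆K
        with maxi (RevElems K) RevElems-isSubmonoid
                  (λ y p → RevElems-mono below⊆K y (⊆RevElems-Pfin0Rev s₁ t₂ cofinite y p)) RevElems⊆
        where open DivisorClosed s₁ s₂ dc
      ... | inj₂ S₂⊆ = ⊥-elim (full⇒improper dc
                                 (λ y p → Elems-mono below⊆K y (⊆Elems-Pfin0Rev s₁ t₂ cofinite y p)) S₂⊆ properK)
      ... | inj₁ ⊆T₂ = λ A k → Pfin0Rev-mono Elems⊆ ⊆T₂ A (proj₁ ≐Pfin0Rev A k)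
        where open DivisorClosed s₁ s₂ dc

    maximal⇔OfMaxSubmonoid : IsMaxDivisorClosed (Pfin0Rev S₁ S₂) H ⇔ (OfMaxSubmonoidˡ H ⊎ OfMaxSubmonoidʳ H)
    maximal⇔OfMaxSubmonoid = mk⇔ maximal⇒OfMaxSubmonoid from
      where
      from : OfMaxSubmonoidˡ H ⊎ OfMaxSubmonoidʳ H → IsMaxDivisorClosed (Pfin0Rev S₁ S₂) H
      from (inj₁ (_ , maxT₁ , H≐)) = IsMaxDivisorClosed-respʳ (≐-sym H≐) (maximalˡ maxT₁)
      from (inj₂ (_ , maxT₂ , H≐)) = IsMaxDivisorClosed-respʳ (≐-sym H≐) (maximalʳ maxT₂)

  maximal-divisor-closed : ExcludedMiddle 0ℓ → IsNumericalMonoid S₁ → IsNumericalMonoid S₂ → ∀ H →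
    IsMaxDivisorClosed (Pfin0 S₁ ∩ revP (Pfin0 S₂)) H ⇔
      ((∃[ S₁′ ] (IsMaxProperSubmonoid S₁ S₁′ × (H ≐ (Pfin0 S₁′ ∩ revP (Pfin0 S₂))))) ⊎
       (∃[ S₂′ ] (IsMaxProperSubmonoid S₂ S₂′ × (H ≐ (Pfin0 S₁ ∩ revP (Pfin0 S₂′))))))
  maximal-divisor-closed em n₁ n₂ H = mk⇔
    (λ maxH → ⊎-map (map₂ (map₂ from-Pfin0Rev)) (map₂ (map₂ from-Pfin0Rev))
                    (Equivalence.to maximal⇔OfMaxSubmonoid (IsMaxDivisorClosed-respˡ Pfin0∩revP≐Pfin0Rev maxH)))
    (λ below → IsMaxDivisorClosed-respˡ (≐-sym Pfin0∩revP≐Pfin0Rev) (Equivalence.from maximal⇔OfMaxSubmonoid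
      (⊎-map (map₂ (map₂ to-Pfin0Rev)) (map₂ (map₂ to-Pfin0Rev)) below)))
    where
    open MaximalDivisorClosed em n₁ n₂
    from-Pfin0Rev : H ≐ Pfin0Rev T₁ T₂ → H ≐ (Pfin0 T₁ ∩ revP (Pfin0 T₂))
    from-Pfin0Rev H≐ = ≐-trans H≐ (≐-sym Pfin0∩revP≐Pfin0Rev)
    to-Pfin0Rev : H ≐ (Pfin0 T₁ ∩ revP (Pfin0 T₂)) → H ≐ Pfin0Rev T₁ T₂
    to-Pfin0Rev H≐ = ≐-trans H≐ Pfin0∩revP≐Pfin0Rev

  -- The case S₁ = S₂ = ℕ₀

  Pfin0-ℕ₀ : 0 ∈ A → Pfin0 ℕ₀ A
  Pfin0-ℕ₀ z = z , All.tabulate (λ {x} _ → x)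

  Pfin0ℕ₀≐Pfin0Rev : Pfin0 ℕ₀ ≐ Pfin0Rev ℕ₀ ℕ₀
  Pfin0ℕ₀≐Pfin0Rev = (λ A p → proj₁ p , proj₂ p , All.tabulate (λ {x} _ → x)) , (λ A p → Pfin0-ℕ₀ (proj₁ p))

  ℕ₀-isSubmonoid : IsSubmonoidℕ ℕ₀
  ℕ₀-isSubmonoid = 0 , λ m n _ _ → m + n

  ℕ₀-isNumerical : IsNumericalMonoid ℕ₀
  ℕ₀-isNumerical = ℕ₀-isSubmonoid , λ d d∣ → ∣1⇒≡1 (d∣ 1 1)

  ℕ₀∖1-isSubmonoid : IsSubmonoidℕ ℕ₀∖1
  ℕ₀∖1-isSubmonoid = (λ ()) , closed
    where
    closed : ∀ m n → ℕ₀∖1 m → ℕ₀∖1 n → ℕ₀∖1 (m + n)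
    closed zero          n _  n≢1 = n≢1
    closed (suc zero)    n 1≢1 _  = ⊥-elim (1≢1 refl)
    closed (suc (suc m)) n _  _   ()

  maxProper-ℕ₀ : IsMaxProperSubmonoid ℕ₀ S → S ≐ₙ ℕ₀∖1
  maxProper-ℕ₀ {S} (s , _ , (x , _ , x∉S) , maximal) = S⊆ℕ₀∖1 , ℕ₀∖1⊆S
    where
    S⊆ℕ₀∖1 : S ⊆ₙ ℕ₀∖1
    S⊆ℕ₀∖1 _ s1 refl = x∉S (contains-1⇒total s s1 x)
    ℕ₀∖1⊆S : ℕ₀∖1 ⊆ₙ S
    ℕ₀∖1⊆S with maximal ℕ₀∖1 ℕ₀∖1-isSubmonoid S⊆ℕ₀∖1 (λ n _ → n)
    ... | inj₁ ℕ₀∖1⊆S = ℕ₀∖1⊆S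
    ... | inj₂ ℕ₀⊆ℕ₀∖1 = ⊥-elim (ℕ₀⊆ℕ₀∖1 1 0 refl)

  1-isAtom : IsAtom ℕ₀ 1
  1-isAtom = 0 , (λ ()) , split
    where
    split : ∀ y z → ℕ → ℕ → 1 ≡ y + z → y ≡ 0 ⊎ z ≡ 0
    split zero    z _ _ _  = inj₁ refl
    split (suc y) z _ _ eq = inj₂ (m+n≡0⇒n≡0 y (sym (suc-injective eq)))

  Pfin0Rev-ℕ₀ʳ : Pfin0Rev S ℕ₀ ≐ Pfin0 S
  Pfin0Rev-ℕ₀ʳ = (λ A p → proj₁ p , proj₁ (proj₂ p)) , (λ A p → proj₁ p , proj₂ p , All.tabulate (λ {x} _ → x))

  Pfin0Rev-ℕ₀ˡ : Pfin0Rev ℕ₀ S ≐ revP (Pfin0 S)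
  Pfin0Rev-ℕ₀ˡ = ≐-trans (≐-sym Pfin0∩revP≐Pfin0Rev) ((λ _ → proj₂) , from)
    where
    from : revP (Pfin0 _) ⊆ (Pfin0 ℕ₀ ∩ revP (Pfin0 _))
    from A r@(B , (zB , _) , A≈revB) = Pfin0-ℕ₀ (∈-≈⁻ A≈revB (0∈rev zB)) , r

  ≐ₙ-refl : S ≐ₙ S
  ≐ₙ-refl = (λ _ p → p) , (λ _ p → p)

  maxProper-Pfin0Revˡ : IsMaxProperSubmonoid ℕ₀ S → Pfin0Rev S ℕ₀ ≐ Pfin0 ℕ₀∖1
  maxProper-Pfin0Revˡ maxS = ≐-trans (Pfin0Rev-cong₂ (maxProper-ℕ₀ maxS) ≐ₙ-refl) Pfin0Rev-ℕ₀ʳ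

  maxProper-Pfin0Revʳ : IsMaxProperSubmonoid ℕ₀ S → Pfin0Rev ℕ₀ S ≐ revP (Pfin0 ℕ₀∖1)
  maxProper-Pfin0Revʳ maxS = ≐-trans (Pfin0Rev-cong₂ ≐ₙ-refl (maxProper-ℕ₀ maxS)) Pfin0Rev-ℕ₀ˡ

  maximal-divisor-closed-ℕ₀ : ExcludedMiddle 0ℓ → ∀ H →
    IsMaxDivisorClosed (Pfin0 ℕ₀) H ⇔ ((H ≐ Pfin0 ℕ₀∖1) ⊎ (H ≐ revP (Pfin0 ℕ₀∖1)))
  maximal-divisor-closed-ℕ₀ em H = mk⇔ to from
    where
    open MaximalDivisorClosed em ℕ₀-isNumerical ℕ₀-isNumerical
    max-without-1 : IsMaxProperSubmonoid ℕ₀ (without ℕ₀ 1)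
    max-without-1 = without-isMaxProper em ℕ₀-isSubmonoid 1-isAtom
    to : IsMaxDivisorClosed (Pfin0 ℕ₀) H → (H ≐ Pfin0 ℕ₀∖1) ⊎ (H ≐ revP (Pfin0 ℕ₀∖1))
    to maxH with Equivalence.to maximal⇔OfMaxSubmonoid (IsMaxDivisorClosed-respˡ Pfin0ℕ₀≐Pfin0Rev maxH)
    ... | inj₁ (_ , maxS , H≐) = inj₁ (≐-trans H≐ (maxProper-Pfin0Revˡ maxS))
    ... | inj₂ (_ , maxS , H≐) = inj₂ (≐-trans H≐ (maxProper-Pfin0Revʳ maxS))
    from : (H ≐ Pfin0 ℕ₀∖1) ⊎ (H ≐ revP (Pfin0 ℕ₀∖1)) → IsMaxDivisorClosed (Pfin0 ℕ₀) H
    from H≐ = IsMaxDivisorClosed-respˡ (≐-sym Pfin0ℕ₀≐Pfin0Rev) (Equivalence.from maximal⇔OfMaxSubmonoid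
      (⊎-map (λ H≐ → _ , max-without-1 , ≐-trans H≐ (≐-sym (maxProper-Pfin0Revˡ max-without-1)))
             (λ H≐ → _ , max-without-1 , ≐-trans H≐ (≐-sym (maxProper-Pfin0Revʳ max-without-1))) H≐))

  ⟦⟧-isDivisorClosed : IsDivisorClosedSubmonoid (Pfin0 ℕ₀) ⟦ A ⟧
  ⟦⟧-isDivisorClosed {A} = ((λ _ → proj₁ ∘ proj₂) , unit , product , respects) , divisors
    where
    unit : ⟦ A ⟧ 𝟘
    unit = 0 , Pfin0-ℕ₀ (here refl) , 𝟘 , Pfin0-ℕ₀ (here refl) , ≈-sym (⊕-identityˡ 𝟘)
    product : ∀ B B′ → ⟦ A ⟧ B → ⟦ A ⟧ B′ → ⟦ A ⟧ (B ⊕ B′)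
    product B B′ (m , (zB , _) , C , (zC , _) , mA≈) (n , (zB′ , _) , C′ , (zC′ , _) , nA≈) =
      m + n , Pfin0-ℕ₀ (∈-⊕⁺ zB zB′) , C ⊕ C′ , Pfin0-ℕ₀ (∈-⊕⁺ zC zC′) ,
      ≈-trans (·-+ m n A) (≈-trans (⊕-cong mA≈ nA≈) (⊕-interchange B C B′ C′))
    respects : ∀ B B′ → B ≈ B′ → ⟦ A ⟧ B → ⟦ A ⟧ B′
    respects B B′ B≈B′ (n , (zB , _) , C , mC , nA≈) =
      n , Pfin0-ℕ₀ (∈-≈⁺ B≈B′ zB) , C , mC , ≈-trans nA≈ (⊕-cong B≈B′ (≈-refl {C}))
    divisors : ∀ B D → ⟦ A ⟧ D → Divides (Pfin0 ℕ₀) B D → ⟦ A ⟧ B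
    divisors B D (n , _ , C′ , (zC′ , _) , nA≈) (mB , C , (zC , _) , D≈) =
      n , mB , C ⊕ C′ , Pfin0-ℕ₀ (∈-⊕⁺ zC zC′) ,
      ≈-trans nA≈ (≈-trans (⊕-cong D≈ (≈-refl {C′})) (⊕-assoc B C C′))

  rev-· : ∀ n → 0 ∈ A → rev (n · A) ≈ (n · rev A)
  rev-· zero      _ = ≈-refl
  rev-· {A} (suc n) z = ≈-trans (rev-⊕ z (0∈· n z)) (⊕-cong (≈-refl {rev A}) (rev-· n z))

  sum≡1⇒1∈ : ∀ xs → sum xs ≡ 1 → 1 ∈ xs
  sum≡1⇒1∈ (zero ∷ xs)      eq = there (sum≡1⇒1∈ xs eq)
  sum≡1⇒1∈ (suc zero ∷ xs)  _  = here refl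

  1∈·⇒1∈ : ∀ n → 1 ∈ n · A → 1 ∈ A
  1∈·⇒1∈ n p with ∈·⇒sum n p
  ... | xs , _ , all , sum≡1 = All.lookup all (sum≡1⇒1∈ xs sum≡1)

  -- {0, 1} divides some n A exactly when 1 ∈ A and 1 ∈ rev A, and then
  -- Elems ⟦ A ⟧ and RevElems ⟦ A ⟧ are monoids containing 1.
  ⟦⟧≐Pfin0ℕ₀⇔ : 0 ∈ A → (⟦ A ⟧ ≐ Pfin0 ℕ₀) ⇔ ((1 ∈ A) × (1 ∈ rev A))
  ⟦⟧≐Pfin0ℕ₀⇔ {A} zA = mk⇔ to from
    where
    to : ⟦ A ⟧ ≐ Pfin0 ℕ₀ → (1 ∈ A) × (1 ∈ rev A)
    to (_ , full) with full (0 ∷ 1 ∷ []) (Pfin0-ℕ₀ (here refl))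
    ... | n , _ , C , (zC , _) , nA≈ =
      1∈·⇒1∈ n (∈-≈⁻ nA≈ (∈-⊕ˡ {A = 0 ∷ 1 ∷ []} (there (here refl)) zC)) ,
      1∈·⇒1∈ n (∈-≈⁺ (rev-· n zA) (∈-≈⁻ (rev-cong nA≈) (∈-rev-⊕ˡ {A = 0 ∷ 1 ∷ []} (here refl) zC (here refl))))
    from : (1 ∈ A) × (1 ∈ rev A) → ⟦ A ⟧ ≐ Pfin0 ℕ₀
    from (1∈A , 1∈revA) = proj₁ (proj₁ ⟦⟧-isDivisorClosed) , λ B pB →
      Pfin0Rev-Elems⊆ B (proj₁ pB , All.tabulate (λ {x} _ → all-Elems x) ,
                                    All.tabulate (λ {y} _ → all-RevElems y))
      where
      open DivisorClosed ℕ₀-isSubmonoid ℕ₀-isSubmonoid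
                         (IsDivisorClosedSubmonoid-respˡ Pfin0ℕ₀≐Pfin0Rev (⟦⟧-isDivisorClosed {A}))
      A∈⟦A⟧ : ⟦ A ⟧ A
      A∈⟦A⟧ = 1 , Pfin0-ℕ₀ zA , 𝟘 , Pfin0-ℕ₀ (here refl) , ≈-refl
      all-Elems : ∀ n → Elems ⟦ A ⟧ n
      all-Elems = contains-1⇒total Elems-isSubmonoid (A , A∈⟦A⟧ , 1∈A)
      all-RevElems : ∀ n → RevElems ⟦ A ⟧ n
      all-RevElems = contains-1⇒total RevElems-isSubmonoid (A , A∈⟦A⟧ , 1∈revA)

  -- Chains

  Tail : ℕ → NSet
  Tail n x = x ≡ 0 ⊎ n < x

  Tail-isSubmonoid : ∀ n → IsSubmonoidℕ (Tail n)
  Tail-isSubmonoid n = inj₁ refl , closed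
    where
    closed : ∀ a b → Tail n a → Tail n b → Tail n (a + b)
    closed a b (inj₁ refl) t = t
    closed a b (inj₂ n<a)  _ = inj₂ (≤-trans n<a (m≤m+n a b))

  descending-chain : ∃[ H ] ((∀ n → IsDivisorClosedSubmonoid (Pfin0 ℕ₀) (H n)) × Descending H × ¬ Stationary H)
  descending-chain = chain , dc , descending , not-stationary
    where
    chain : ℕ → FPred
    chain n = Pfin0Rev (Tail n) ℕ₀
    dc : ∀ n → IsDivisorClosedSubmonoid (Pfin0 ℕ₀) (chain n)
    dc n = IsDivisorClosedSubmonoid-respˡ (≐-sym Pfin0ℕ₀≐Pfin0Rev)
             (Pfin0Rev-isDivisorClosed (Tail-isSubmonoid n) ℕ₀-isSubmonoid (λ x _ → x) (λ _ p → p))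
    descending : Descending chain
    descending n = Pfin0Rev-mono shrink (λ _ p → p)
      where
      shrink : Tail (suc n) ⊆ₙ Tail n
      shrink x (inj₁ x≡0) = inj₁ x≡0
      shrink x (inj₂ n<x) = inj₂ (<-trans (n<1+n n) n<x)
    not-stationary : ¬ Stationary chain
    not-stationary (N , stationary)
      with proj₂ (stationary (suc N) (n≤1+n N)) (0 ∷ suc N ∷ [])
                 (here refl , inj₁ refl ∷ inj₂ ≤-refl ∷ [] , All.tabulate (λ {x} _ → x))
    ... | _ , _ ∷ inj₁ () ∷ [] , _
    ... | _ , _ ∷ inj₂ N+1<N+1 ∷ [] , _ = <-irrefl refl N+1<N+1

  ascending⇒⊆ : ∀ {I : Set} (T : ℕ → I → Set) → (∀ n i → T n i → T (suc n) i) →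
                ∀ {m n} → m ≤ n → ∀ i → T m i → T n i
  ascending⇒⊆ T step m≤n = go (≤⇒≤′ m≤n)
    where
    go : ∀ {m n} → m ≤′ n → ∀ i → T m i → T n i
    go ≤′-refl       i t = t
    go (≤′-step m≤n) i t = step _ i (go m≤n i t)

  common-bound : (P : ℕ → ℕ → Set) → (∀ {r N N′} → N ≤ N′ → P r N → P r N′) →
                 (∀ r → ∃[ N ] P r N) → ∀ k → ∃[ N ] (∀ r → r < k → P r N)
  common-bound P mono bound zero    = 0 , λ _ ()
  common-bound P mono bound (suc k) with common-bound P mono bound k | bound k
  ... | N , below-k | Nₖ , at-k = N + Nₖ , below-suc-k
    where
    below-suc-k : ∀ r → r < suc k → P r (N + Nₖ)
    below-suc-k r r<1+k with m≤n⇒m<n∨m≡n (s≤s⁻¹ r<1+k)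
    ... | inj₁ r<k  = mono (m≤m+n N Nₖ) (below-k r r<k)
    ... | inj₂ refl = mono (m≤n+m Nₖ N) at-k

  -- For u ≠ 0 in the union, each residue class modulo u of the union is
  -- w + u ℕ for its least element w, so a single stage contains it.
  ascending-submonoids-stabilise : ExcludedMiddle 0ℓ → (T : ℕ → NSet) → (∀ n → IsSubmonoidℕ (T n)) →
                                   (∀ n → T n ⊆ₙ T (suc n)) → ∃[ N ] (∀ m → T m ⊆ₙ T N)
  ascending-submonoids-stabilise em T sub asc with em {∃[ u ] ((∃[ n ] T n u) × u ≢ 0)}
  ... | no  trivial = 0 , λ m x tx → only-0 m x tx
    where
    only-0 : ∀ m x → T m x → T 0 x
    only-0 m x tx with x ≟ 0
    ... | yes refl = proj₁ (sub 0)
    ... | no  x≢0  = ⊥-elim (trivial (x , (m , tx) , x≢0))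
  ... | yes (u , (nᵤ , tu) , u≢0) with common-bound ResidueBound mono residue-bound u
    where
    instance _ = ≢-nonZero u≢0
    ⊆T : ∀ {m n} → m ≤ n → T m ⊆ₙ T n
    ⊆T = ascending⇒⊆ T asc
    ResidueBound : ℕ → ℕ → Set
    ResidueBound r N = ∀ x → (∃[ n ] T n x) → x % u ≡ r → T N x
    mono : ∀ {r N N′} → N ≤ N′ → ResidueBound r N → ResidueBound r N′
    mono N≤N′ bound x ux eq = ⊆T N≤N′ x (bound x ux eq)
    residue-bound : ∀ r → ∃[ N ] ResidueBound r N
    residue-bound r with em {∃[ x ] ((∃[ n ] T n x) × x % u ≡ r)}
    ... | no  empty = 0 , λ x ux eq → ⊥-elim (empty (x , ux , eq))
    ... | yes (x , p) with least em (λ x → (∃[ n ] T n x) × x % u ≡ r) p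
    ...   | w , ((n , tw) , w%u) , minimal = n + nᵤ , bound
      where
      bound : ResidueBound r (n + nᵤ)
      bound x ux x%u with w ≤? x
      ... | no  w≰x = ⊥-elim (minimal x (≰⇒> w≰x) (ux , x%u))
      ... | yes w≤x with [m+n]%d≡m%d⇒d∣n u w (x ∸ w) (trans (cong (_% u) (m+[n∸m]≡n w≤x)) (trans x%u (sym w%u)))
      ...   | divides q x∸w≡qu =
              subst (T (n + nᵤ)) (trans (cong (w +_) (sym x∸w≡qu)) (m+[n∸m]≡n w≤x))
                    (proj₂ (sub (n + nᵤ)) w (q * u) (⊆T (m≤m+n n nᵤ) w tw)
                                          (*-closed (sub (n + nᵤ)) (⊆T (m≤n+m nᵤ n) u tu) q))
  ... | N , bound = N , λ m x tx → bound (x % u) (m%n<n x u) x (m , tx) refl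
    where instance _ = ≢-nonZero u≢0

  ascending-chains-stabilise : ExcludedMiddle 0ℓ → ∀ (H : ℕ → FPred) →
    (∀ n → IsDivisorClosedSubmonoid (Pfin0 ℕ₀) (H n)) → Ascending H → Stationary H
  ascending-chains-stabilise em H dc asc = N₁ + N₂ , λ m N≤m → below m , ascending⇒⊆ H asc N≤m
    where
    module Dc (n : ℕ) = DivisorClosed ℕ₀-isSubmonoid ℕ₀-isSubmonoid
                                      (IsDivisorClosedSubmonoid-respˡ Pfin0ℕ₀≐Pfin0Rev (dc n))
    stable-Elems : ∃[ N ] (∀ m → Elems (H m) ⊆ₙ Elems (H N))
    stable-Elems = ascending-submonoids-stabilise em (Elems ∘ H) Dc.Elems-isSubmonoid (λ n → Elems-mono (asc n))
    stable-RevElems : ∃[ N ] (∀ m → RevElems (H m) ⊆ₙ RevElems (H N))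
    stable-RevElems = ascending-submonoids-stabilise em (RevElems ∘ H) Dc.RevElems-isSubmonoid
                                                     (λ n → RevElems-mono (asc n))
    N₁ N₂ : ℕ
    N₁ = proj₁ stable-Elems
    N₂ = proj₁ stable-RevElems
    below : ∀ m → H m ⊆ H (N₁ + N₂)
    below m A h = Dc.Pfin0Rev-Elems⊆ (N₁ + N₂) A
      (Pfin0Rev-mono (λ x p → Elems-mono (ascending⇒⊆ H asc (m≤m+n N₁ N₂)) x (proj₂ stable-Elems m x p))
                     (λ y p → RevElems-mono (ascending⇒⊆ H asc (m≤n+m N₂ N₁)) y (proj₂ stable-RevElems m y p))
                     A (proj₁ (Dc.≐Pfin0Rev m) A h))

open import Level using (0ℓ; suc)
open import Axiom.ExcludedMiddle using (ExcludedMiddle)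
open import Data.Nat using (ℕ)
open import Data.List.Membership.Propositional using (_∈_)
open import Data.Product using (_×_; ∃-syntax; _,_)
open import Data.Sum using (_⊎_)
open import Relation.Nullary using (¬_)
open import Function.Bundles using (_⇔_)

theorem4p5 : ExcludedMiddle 0ℓ → ExcludedMiddle (suc 0ℓ) →
    -- (1)
    (∀ (A : FSet) → 0 ∈ A →
      ((⟦ A ⟧ ≐ Pfin0 ℕ₀) ⇔ ((1 ∈ A) × (1 ∈ rev A))))
    ×
    -- (2), the case of P_fin,0(ℕ₀)
    (∀ (H : FPred) →
      (IsMaxDivisorClosed (Pfin0 ℕ₀) H ⇔
        ((H ≐ Pfin0 ℕ₀∖1) ⊎ (H ≐ revP (Pfin0 ℕ₀∖1)))))
    ×
    -- (2), general numerical monoids S₁, S₂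
    (∀ (S₁ S₂ : NSet) → IsNumericalMonoid S₁ → IsNumericalMonoid S₂ →
      ∀ (H : FPred) →
      (IsMaxDivisorClosed (Pfin0 S₁ ∩ revP (Pfin0 S₂)) H ⇔
        ((∃[ S₁' ] (IsMaxProperSubmonoid S₁ S₁' ×
                    (H ≐ (Pfin0 S₁' ∩ revP (Pfin0 S₂)))))
         ⊎
         (∃[ S₂' ] (IsMaxProperSubmonoid S₂ S₂' ×
                    (H ≐ (Pfin0 S₁ ∩ revP (Pfin0 S₂'))))))))
    ×
    -- (3)
    (∃[ H ] ((∀ n → IsDivisorClosedSubmonoid (Pfin0 ℕ₀) (H n)) ×
             Descending H × ¬ Stationary H))
    ×
    -- (4)
    (∀ (H : ℕ → FPred) →
      (∀ n → IsDivisorClosedSubmonoid (Pfin0 ℕ₀) (H n)) →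
      Ascending H → Stationary H)
theorem4p5 em _ =
  (λ _ → ⟦⟧≐Pfin0ℕ₀⇔) ,
  maximal-divisor-closed-ℕ₀ em ,
  (λ _ _ → maximal-divisor-closed em) ,
  descending-chain ,
  ascending-chains-stabilise em
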